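{- Let $(N,\preceq,F)$ be a transitive-closed description of a simply dependent multimodal logic. Then the end-active variant of the calculus $\mathsf{LNS}_{(N,\preceq,F)}$ extended with contraction and weakening is sound and complete for $\mathcal{L}_{(N,\preceq,F)}$: for every formula $A$, $A\in\mathcal{L}_{(N,\preceq,F)}$ iff $\;\Rightarrow A$ is derivable in the end-active variant.
   Context: A description is a triple $(N,\preceq,F)$ with $N$ a finite set of natural numbers, $\preceq$ a partial order on $N$, and each $F(i)$ the extension of modal logic $\mathsf{K}$ by some subset of $\mathsf{D}: \neg\Box\bot$, $\mathsf{T}: \Box A\to A$, $\mathsf{4}: \Box A\to\Box\Box A$; $\mathsf{KAx}\subseteq F(i)$ means $F(i)$ proves all theorems of $\mathsf{K}+\mathsf{Ax}$. Formulas use propositional variables, $\bot,\top,\neg,\land,\lor,\to$, $\Box_i$ ($i\in N$). $\mathcal{L}_{(N,\preceq,F)}$ is the smallest set containing propositional tautologies, $\Box_i(A\to B)\to(\Box_iA\to\Box_iB)$ and $\Box_i$-instances of the extra axioms of $F(i)$, and $\Box_jA\to\Box_iA$ for $i\preceq j$, closed under modus ponens and necessitation for each $\Box_i$. Transitive-closed: $i\preceq j$, $\mathsf{K4}\subseteq F(i)$ imply $\mathsf{K4}\subseteq F(j)$. Standing assumption: for $i\preceq j$, $\mathsf{KD}\subseteq F(i)\Rightarrow\mathsf{KD}\subseteq F(j)$ and $\mathsf{KT}\subseteq F(i)\Rightarrow\mathsf{KT}\subseteq F(j)$. Linear nested sequents: finite nonempty lists $\Gamma_1\Rightarrow\Delta_1/_{i_1}\cdots/_{i_{n-1}}\Gamma_n\Rightarrow\Delta_n$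 of sequents (components) separated by $/_i$, $i\in N$; $\mathcal{S}\{\Gamma\Rightarrow\Delta\}$ has a distinguished component, $\mathcal{G}/_k\Gamma\Rightarrow\Delta$ has last component $\Gamma\Rightarrow\Delta$ (prefix possibly empty). Calculus: propositional rules (zero-premiss $\mathcal{S}\{\Gamma,p\Rightarrow p,\Delta\}$ with $p$ atomic, $\mathcal{S}\{\Gamma,\bot\Rightarrow\Delta\}$, $\mathcal{S}\{\Gamma\Rightarrow\top,\Delta\}$, and the standard two-sided invertible rules for $\neg,\land,\lor,\to$ applied inside a component), contraction and weakening inside a component, and modal rules: $(\Box_{ij})_L$ ($j\preceq i$): $\mathcal{S}\{\Gamma\Rightarrow\Delta/_j\Sigma,A\Rightarrow\Pi\}$ / $\mathcal{S}\{\Gamma,\Box_iA\Rightarrow\Delta/_j\Sigma\Rightarrow\Pi\}$; $(\Box_i)_R$: $\mathcal{G}/_k\Gamma\Rightarrow\Delta/_i\Rightarrow A$ / $\mathcal{G}/_k\Gamma\Rightarrow\Delta,\Box_iA$; $\mathsf{d}_{ij}$ ($j\preceq i$, $\mathsf{KD}\subseteq F(j)$): $\mathcal{G}/_k\Gamma\Rightarrow\Delta/_jA\Rightarrow$ / $\mathcal{G}/_k\Gamma,\Box_iA\Rightarrow\Delta$; $\mathsf{t}_i$ ($\mathsf{KT}\subseteq F(i)$): $\mathcal{S}\{\Gamma,A\Rightarrow\Delta\}$ / $\mathcal{S}\{\Gamma,\Box_iA\Rightarrow\Delta\}$; $\mathsf{4}_{ij}$ ($j\preceq i$, $\mathsf{K4}\subseteq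 F(i)$): $\mathcal{S}\{\Gamma\Rightarrow\Delta/_j\Sigma,\Box_iA\Rightarrow\Pi\}$ / $\mathcal{S}\{\Gamma,\Box_iA\Rightarrow\Delta/_j\Sigma\Rightarrow\Pi\}$. An application of a rule is end-active if the rightmost components of its premisses are active and the only active components (in premisses and conclusion) are the two rightmost ones; the end-active variant of a calculus restricts all rules to end-active applications. -}

module Defs where

open import Data.Nat using (ℕ)
open import Data.Bool using (Bool; true; false; _∧_; _∨_; not)
open import Data.List using (List; []; _∷_)
open import Data.List.Membership.Propositional using (_∈_)
open import Data.List.Relation.Binary.Permutation.Propositional using (_↭_)
open import Data.Product using (_×_)
open import Data.Sum using (_⊎_)
open import Relation.Binary.PropositionalEquality using (_≡_)

data Ax : Set where
  AxD AxT Ax4 : Ax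

record Description : Set₁ where
  field
    N    : List ℕ
    _⪯_  : ℕ → ℕ → Set
    ⪯-refl    : ∀ {i} → i ∈ N → i ⪯ i
    ⪯-trans   : ∀ {i j k} → i ∈ N → j ∈ N → k ∈ N → i ⪯ j → j ⪯ k → i ⪯ k
    ⪯-antisym : ∀ {i j} → i ∈ N → j ∈ N → i ⪯ j → j ⪯ i → i ≡ j
    -- F i ax ≡ true  iff  ax is among the extra axioms of F(i) = K + {ax | ...}
    F    : ℕ → Ax → Bool

module _ (𝔇 : Description) where
  open Description 𝔇

  -- "K Ax ⊆ F(i)": F(i) proves all theorems of K + Ax.
  -- KD ⊆ K+S iff D ∈ S or T ∈ S;  KT ⊆ K+S iff T ∈ S;  K4 ⊆ K+S iff 4 ∈ S.
  KD⊆ : ℕ → Set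
  KD⊆ i = F i AxD ≡ true ⊎ F i AxT ≡ true

  KT⊆ : ℕ → Set
  KT⊆ i = F i AxT ≡ true

  K4⊆ : ℕ → Set
  K4⊆ i = F i Ax4 ≡ true

  TransitiveClosed : Set
  TransitiveClosed = ∀ {i j} → i ∈ N → j ∈ N → i ⪯ j → K4⊆ i → K4⊆ j

  StandingAssumption : Set
  StandingAssumption = ∀ {i j} → i ∈ N → j ∈ N → i ⪯ j →
    (KD⊆ i → KD⊆ j) × (KT⊆ i → KT⊆ j)

infixr 9 _∧'_
infixr 8 _∨'_
infixr 7 _⇒'_
infix 10 ¬'_

data Fm : Set where
  var  : ℕ → Fm
  ⊥'   : Fm
  ⊤'   : Fm
  ¬'_  : Fm → Fm
  _∧'_ : Fm → Fm → Fm
  _∨'_ : Fm → Fm → Fm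
  _⇒'_ : Fm → Fm → Fm
  □    : ℕ → Fm → Fm

data WF (N : List ℕ) : Fm → Set where
  wf-var : ∀ {p} → WF N (var p)
  wf-⊥   : WF N ⊥'
  wf-⊤   : WF N ⊤'
  wf-¬   : ∀ {A} → WF N A → WF N (¬' A)
  wf-∧   : ∀ {A B} → WF N A → WF N B → WF N (A ∧' B)
  wf-∨   : ∀ {A B} → WF N A → WF N B → WF N (A ∨' B)
  wf-⇒   : ∀ {A B} → WF N A → WF N B → WF N (A ⇒' B)
  wf-□   : ∀ {i A} → i ∈ N → WF N A → WF N (□ i A)

eval : (Fm → Bool) → Fm → Bool
eval v (var p)  = v (var p)
eval v ⊥'       = false
eval v ⊤'       = true
eval v (¬' A)   = not (eval v A)
eval v (A ∧' B) = eval v A ∧ eval v B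
eval v (A ∨' B) = eval v A ∨ eval v B
eval v (A ⇒' B) = not (eval v A) ∨ eval v B
eval v (□ i A)  = v (□ i A)

-- (instance of a) propositional tautology
Taut : Fm → Set
Taut A = ∀ (v : Fm → Bool) → eval v A ≡ true

module _ (𝔇 : Description) where
  open Description 𝔇

  data L : Fm → Set where
    taut : ∀ {A} → WF N A → Taut A → L A
    axK  : ∀ {i A B} → i ∈ N → WF N A → WF N B →
           L (□ i (A ⇒' B) ⇒' (□ i A ⇒' □ i B))
    axD  : ∀ {i} → i ∈ N → F i AxD ≡ true → L (¬' □ i ⊥')
    axT  : ∀ {i A} → i ∈ N → WF N A → F i AxT ≡ true → L (□ i A ⇒' A)
    ax4  : ∀ {i A} → i ∈ N → WF N A → F i Ax4 ≡ true → L (□ i A ⇒' □ i (□ i A))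
    axInc : ∀ {i j A} → i ∈ N → j ∈ N → WF N A → i ⪯ j → L (□ j A ⇒' □ i A)
    mp   : ∀ {A B} → L (A ⇒' B) → L A → L B
    nec  : ∀ {i A} → i ∈ N → L A → L (□ i A)

infix 2 _⇒_

record Seq : Set where
  constructor _⇒_
  field
    ant : List Fm
    suc : List Fm

data LNS : Set where
  one    : Seq → LNS
  _/[_]_ : LNS → ℕ → Seq → LNS

data Pre : Set where
  ε    : Pre
  _/⟨_⟩ : LNS → ℕ → Pre

_⊳_ : Pre → Seq → LNS
ε ⊳ s = one s
(G /⟨ k ⟩) ⊳ s = G /[ k ] s

-- componentwise permutation: components are multisets
data _≈_ : LNS → LNS → Set where
  one≈ : ∀ {Γ Γ' Δ Δ'} → Γ ↭ Γ' → Δ ↭ Δ' → one (Γ ⇒ Δ) ≈ one (Γ' ⇒ Δ')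
  ext≈ : ∀ {G G' k Γ Γ' Δ Δ'} → G ≈ G' → Γ ↭ Γ' → Δ ↭ Δ' →
         (G /[ k ] (Γ ⇒ Δ)) ≈ (G' /[ k ] (Γ' ⇒ Δ'))

-- Every rule application acts on the rightmost component (one-component
-- rules) or on the two rightmost components (modal rules).

module _ (𝔇 : Description) where
  open Description 𝔇

  data EA : LNS → Set where
    -- multiset reading of components (not a rule)
    perm : ∀ {S S'} → S ≈ S' → EA S → EA S'
    init  : ∀ {P p Γ Δ} → EA (P ⊳ (var p ∷ Γ ⇒ var p ∷ Δ))
    init' : ∀ {P p Γ Δ j s} → j ∈ N → EA ((P ⊳ (var p ∷ Γ ⇒ var p ∷ Δ)) /[ j ] s)
    ⊥L    : ∀ {P Γ Δ} → EA (P ⊳ (⊥' ∷ Γ ⇒ Δ))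
    ⊥L'   : ∀ {P Γ Δ j s} → j ∈ N → EA ((P ⊳ (⊥' ∷ Γ ⇒ Δ)) /[ j ] s)
    ⊤R    : ∀ {P Γ Δ} → EA (P ⊳ (Γ ⇒ ⊤' ∷ Δ))
    ⊤R'   : ∀ {P Γ Δ j s} → j ∈ N → EA ((P ⊳ (Γ ⇒ ⊤' ∷ Δ)) /[ j ] s)
    ¬L : ∀ {P Γ Δ A} → EA (P ⊳ (Γ ⇒ A ∷ Δ)) → EA (P ⊳ (¬' A ∷ Γ ⇒ Δ))
    ¬R : ∀ {P Γ Δ A} → EA (P ⊳ (A ∷ Γ ⇒ Δ)) → EA (P ⊳ (Γ ⇒ ¬' A ∷ Δ))
    ∧L : ∀ {P Γ Δ A B} → EA (P ⊳ (A ∷ B ∷ Γ ⇒ Δ)) → EA (P ⊳ (A ∧' B ∷ Γ ⇒ Δ))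
    ∧R : ∀ {P Γ Δ A B} → EA (P ⊳ (Γ ⇒ A ∷ Δ)) → EA (P ⊳ (Γ ⇒ B ∷ Δ)) →
         EA (P ⊳ (Γ ⇒ A ∧' B ∷ Δ))
    ∨L : ∀ {P Γ Δ A B} → EA (P ⊳ (A ∷ Γ ⇒ Δ)) → EA (P ⊳ (B ∷ Γ ⇒ Δ)) →
         EA (P ⊳ (A ∨' B ∷ Γ ⇒ Δ))
    ∨R : ∀ {P Γ Δ A B} → EA (P ⊳ (Γ ⇒ A ∷ B ∷ Δ)) → EA (P ⊳ (Γ ⇒ A ∨' B ∷ Δ))
    ⇒L : ∀ {P Γ Δ A B} → EA (P ⊳ (Γ ⇒ A ∷ Δ)) → EA (P ⊳ (B ∷ Γ ⇒ Δ)) →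
         EA (P ⊳ (A ⇒' B ∷ Γ ⇒ Δ))
    ⇒R : ∀ {P Γ Δ A B} → EA (P ⊳ (A ∷ Γ ⇒ B ∷ Δ)) → EA (P ⊳ (Γ ⇒ A ⇒' B ∷ Δ))
    conL : ∀ {P Γ Δ A} → EA (P ⊳ (A ∷ A ∷ Γ ⇒ Δ)) → EA (P ⊳ (A ∷ Γ ⇒ Δ))
    conR : ∀ {P Γ Δ A} → EA (P ⊳ (Γ ⇒ A ∷ A ∷ Δ)) → EA (P ⊳ (Γ ⇒ A ∷ Δ))
    wkL  : ∀ {P Γ Δ A} → EA (P ⊳ (Γ ⇒ Δ)) → EA (P ⊳ (A ∷ Γ ⇒ Δ))
    wkR  : ∀ {P Γ Δ A} → EA (P ⊳ (Γ ⇒ Δ)) → EA (P ⊳ (Γ ⇒ A ∷ Δ))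
    □L : ∀ {P Γ Δ Σ Π A i j} → i ∈ N → j ∈ N → j ⪯ i →
         EA ((P ⊳ (Γ ⇒ Δ)) /[ j ] (A ∷ Σ ⇒ Π)) →
         EA ((P ⊳ (□ i A ∷ Γ ⇒ Δ)) /[ j ] (Σ ⇒ Π))
    □R : ∀ {P Γ Δ A i} → i ∈ N →
         EA ((P ⊳ (Γ ⇒ Δ)) /[ i ] ([] ⇒ A ∷ [])) →
         EA (P ⊳ (Γ ⇒ □ i A ∷ Δ))
    d  : ∀ {P Γ Δ A i j} → i ∈ N → j ∈ N → j ⪯ i → KD⊆ 𝔇 j →
         EA ((P ⊳ (Γ ⇒ Δ)) /[ j ] (A ∷ [] ⇒ [])) →
         EA (P ⊳ (□ i A ∷ Γ ⇒ Δ))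
    t  : ∀ {P Γ Δ A i} → i ∈ N → KT⊆ 𝔇 i →
         EA (P ⊳ (A ∷ Γ ⇒ Δ)) → EA (P ⊳ (□ i A ∷ Γ ⇒ Δ))
    f4 : ∀ {P Γ Δ Σ Π A i j} → i ∈ N → j ∈ N → j ⪯ i → K4⊆ 𝔇 i →
         EA ((P ⊳ (Γ ⇒ Δ)) /[ j ] (□ i A ∷ Σ ⇒ Π)) →
         EA ((P ⊳ (□ i A ∷ Γ ⇒ Δ)) /[ j ] (Σ ⇒ Π))

-- A linear nested sequent Γ₁ ⇒ Δ₁ /ᵢ … /ₖ Γₙ ⇒ Δₙ is read as the formula
-- ∧Γ₁ → ∨Δ₁ ∨ □ᵢ(… □ₖ(∧Γₙ → ∨Δₙ)). The prefix in front of the last component is then a formula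
-- context which, like a box, preserves theorems and distributes over implication, so an end-active
-- rule is sound as soon as its effect on the last one or two components is; that is propositional
-- reasoning together with the axioms K, D, T, 4 and □ⱼA → □ᵢA (i ⪯ j).
--
-- Theorems of L are derived in a G3-style calculus whose modal rules (□R, D) open a
-- new component filled with formulas transferred from the antecedent: B for □ₖB with j ⪯ k, or □ₖB
-- itself when k has axiom 4. Tautologies are found by invertible proof search, the axioms directly,
-- and modus ponens is a cut. Cut is admissible: for a principal cut on □ᵢA against a modal rule,
-- transitive-closedness lets the transfers of the □ᵢA-derivation be re-boxed into the new component,
-- and the standing assumption propagates T along ⪯. Finally, every G3 derivation is replayed after an
-- arbitrary prefix as an end-active derivation, each modal rule becoming □L/4 steps into a fresh last
-- component closed by □R or d.

module Submission where

open import Defs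
open import Data.Bool using (Bool; true; false; T; not; _∧_; _∨_)
import Data.Bool
open import Data.Bool.Properties using (T-≡; T-∧; T-∨)
open import Data.Empty using (⊥; ⊥-elim)
import Data.Nat as ℕ
open import Data.Nat using (ℕ; suc; _+_; _⊔_; _≤_; _<_; s≤s; _≤′_; ≤′-refl; ≤′-step)
open import Data.Nat.Properties
  using (+-assoc; ≤-trans; ≤-refl; +-monoˡ-≤; m≤m+n; m≤n+m; m≤m⊔n; m≤n⊔m; ≤⇒≤′)
open import Data.List using (List; []; _∷_; _++_)
open import Data.List.Properties using (++-identityʳ)
open import Data.List.Membership.Propositional using (_∈_; find)
open import Data.List.Membership.Propositional.Properties using (∈-++⁺ˡ; ∈-++⁺ʳ; ∈-∃++)
open import Data.List.Relation.Unary.All using (All; []; _∷_)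
import Data.List.Relation.Unary.All as All
import Data.List.Relation.Unary.All.Properties as All
open import Data.List.Relation.Unary.Any using (Any; here; there; any?)
import Data.List.Relation.Unary.Any as Any
open import Data.List.Relation.Binary.Permutation.Propositional
  using (_↭_; ↭-refl; ↭-sym; ↭-reflexive; prep)
open import Data.List.Relation.Binary.Permutation.Propositional.Properties
  using (All-resp-↭; Any-resp-↭; shift; ++-comm)
open import Data.List.Relation.Binary.Subset.Propositional using (_⊆_)
open import Data.List.Relation.Binary.Subset.Propositional.Properties
  using (⊆-refl; ∷⁺ʳ; xs⊆xs++ys; ⊆-reflexive-↭)
open import Data.Product using (_×_; _,_; proj₁; proj₂; ∃-syntax)
open import Data.Sum using (_⊎_; inj₁; inj₂; [_,_]′)
import Data.Sum
open import Data.Unit using (⊤)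
open import Function using (_∘_; _∘′_; id; case_of_)
open import Function.Bundles using (_⇔_; mk⇔; Equivalence)
open import Relation.Nullary using (¬_; Dec; yes; no)
open import Relation.Nullary.Decidable using (T?; map′; _×-dec_; isYes; toWitness; fromWitness)
open import Relation.Binary.Definitions using (DecidableEquality)
open import Relation.Binary.PropositionalEquality using (_≡_; refl; cong; cong₂; subst; trans; sym)

open Equivalence using (to; from)

Valuation : Set
Valuation = Fm → Bool

infix 4 _⊨_ _⊨ˢ_ _⊫_
infixr 6 _⇛_

-- A record rather than T (eval v A), so that v and A can be inferred from v ⊨ A.
record _⊨_ (v : Valuation) (A : Fm) : Set where
  constructor ⊨⟨_⟩
  field holds : T (eval v A)

open _⊨_ using (holds)

_⊨?_ : ∀ v A → Dec (v ⊨ A)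
v ⊨? A with T? (eval v A)
... | yes a = yes ⊨⟨ a ⟩
... | no ¬a = no (¬a ∘ holds)

⊨-¬ : ∀ {v A} → v ⊨ ¬' A ⇔ (¬ v ⊨ A)
⊨-¬ {v} {A} = mk⇔ (λ h a → to (T-not (eval v A)) (holds h) (holds a))
                  (λ f → ⊨⟨ from (T-not (eval v A)) (f ∘ ⊨⟨_⟩) ⟩)
  where
  T-not : ∀ b → T (not b) ⇔ (¬ T b)
  T-not true  = mk⇔ (λ ()) (λ f → f _)
  T-not false = mk⇔ (λ _ ()) (λ _ → _)

⊨-∧ : ∀ {v A B} → v ⊨ A ∧' B ⇔ (v ⊨ A × v ⊨ B)
⊨-∧ {v} {A} {B} = mk⇔ (λ h → let a , b = to (T-∧ {eval v A}) (holds h) in ⊨⟨ a ⟩ , ⊨⟨ b ⟩)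
                      (λ { (a , b) → ⊨⟨ from (T-∧ {eval v A}) (holds a , holds b) ⟩ })

⊨-∨ : ∀ {v A B} → v ⊨ A ∨' B ⇔ (v ⊨ A ⊎ v ⊨ B)
⊨-∨ {v} {A} {B} = mk⇔ (Data.Sum.map ⊨⟨_⟩ ⊨⟨_⟩ ∘ to (T-∨ {eval v A}) ∘ holds)
                      (⊨⟨_⟩ ∘ from (T-∨ {eval v A}) ∘ Data.Sum.map holds holds)

⊨-⇒ : ∀ {v A B} → v ⊨ A ⇒' B ⇔ (v ⊨ A → v ⊨ B)
⊨-⇒ {v} {A} {B} = mk⇔ (λ h a → ⊨⟨ to (T-⇒ (eval v A)) (holds h) (holds a) ⟩)
                      (λ f → ⊨⟨ from (T-⇒ (eval v A)) (holds ∘ f ∘ ⊨⟨_⟩) ⟩)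
  where
  T-⇒ : ∀ a {b} → T (not a ∨ b) ⇔ (T a → T b)
  T-⇒ true  = mk⇔ (λ b _ → b) (λ f → f _)
  T-⇒ false = mk⇔ (λ _ ()) (λ _ → _)

conj : List Fm → Fm
conj []      = ⊤'
conj (A ∷ Γ) = A ∧' conj Γ

disj : List Fm → Fm
disj []      = ⊥'
disj (A ∷ Δ) = A ∨' disj Δ

⊨-conj : ∀ {v} Γ → v ⊨ conj Γ ⇔ All (v ⊨_) Γ
⊨-conj []      = mk⇔ (λ _ → []) (λ _ → _)
⊨-conj (A ∷ Γ) = mk⇔
  (λ h → let a , γ = to ⊨-∧ h in a ∷ to (⊨-conj Γ) γ)
  (λ { (a ∷ γ) → from ⊨-∧ (a , from (⊨-conj Γ) γ) })

⊨-disj : ∀ {v} Δ → v ⊨ disj Δ ⇔ Any (v ⊨_) Δ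
⊨-disj []      = mk⇔ (λ { ⊨⟨ () ⟩ }) (λ ())
⊨-disj (A ∷ Δ) = mk⇔
  (λ h → [ here , there ∘ to (⊨-disj Δ) ]′ (to ⊨-∨ h))
  (λ { (here a) → from ⊨-∨ (inj₁ a) ; (there δ) → from ⊨-∨ (inj₂ (from (⊨-disj Δ) δ)) })

⌜_⌝ : Seq → Fm
⌜ Γ ⇒ Δ ⌝ = conj Γ ⇒' disj Δ

_⊨ˢ_ : Valuation → Seq → Set
v ⊨ˢ (Γ ⇒ Δ) = All (v ⊨_) Γ → Any (v ⊨_) Δ

Valid : Seq → Set
Valid s = ∀ {v} → v ⊨ˢ s

⊨-⌜⌝ : ∀ {v} s → v ⊨ ⌜ s ⌝ ⇔ v ⊨ˢ s
⊨-⌜⌝ (Γ ⇒ Δ) = mk⇔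
  (λ h γ → to (⊨-disj Δ) (to ⊨-⇒ h (from (⊨-conj Γ) γ)))
  (λ h → from ⊨-⇒ (from (⊨-disj Δ) ∘ h ∘ to (⊨-conj Γ)))

⊨ˢ-resp-↭ : ∀ {v Γ Γ' Δ Δ'} → Γ ↭ Γ' → Δ ↭ Δ' → v ⊨ˢ (Γ ⇒ Δ) → v ⊨ˢ (Γ' ⇒ Δ')
⊨ˢ-resp-↭ p q h = Any-resp-↭ q ∘ h ∘ All-resp-↭ (↭-sym p)

Any-mapʰ : ∀ {P : Fm → Set} {x y Δ} → (P x → P y) → Any P (x ∷ Δ) → Any P (y ∷ Δ)
Any-mapʰ f (here px) = here (f px)
Any-mapʰ f (there δ) = there δ

Any-zipʰ : ∀ {P : Fm → Set} {x y z Δ} → (P x → P y → P z) →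
           Any P (x ∷ Δ) → Any P (y ∷ Δ) → Any P (z ∷ Δ)
Any-zipʰ f (here px) (here py) = here (f px py)
Any-zipʰ f (here _)  (there δ) = there δ
Any-zipʰ f (there δ) _         = there δ

⊨ˢ-¬ˡ : ∀ {v A Γ Δ} → v ⊨ˢ (¬' A ∷ Γ ⇒ Δ) ⇔ v ⊨ˢ (Γ ⇒ A ∷ Δ)
⊨ˢ-¬ˡ {v} {A} = mk⇔
  (λ h γ → case v ⊨? A of λ { (yes a) → here a ; (no na) → there (h (from ⊨-¬ na ∷ γ)) })
  (λ { h (na ∷ γ) → Any.tail (to ⊨-¬ na) (h γ) })

⊨ˢ-¬ʳ : ∀ {v A Γ Δ} → v ⊨ˢ (Γ ⇒ ¬' A ∷ Δ) ⇔ v ⊨ˢ (A ∷ Γ ⇒ Δ)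
⊨ˢ-¬ʳ {v} {A} = mk⇔
  (λ { h (a ∷ γ) → Any.tail (λ na → to ⊨-¬ na a) (h γ) })
  (λ h γ → case v ⊨? A of λ { (yes a) → there (h (a ∷ γ)) ; (no na) → here (from ⊨-¬ na) })

⊨ˢ-∧ˡ : ∀ {v A B Γ Δ} → v ⊨ˢ (A ∧' B ∷ Γ ⇒ Δ) ⇔ v ⊨ˢ (A ∷ B ∷ Γ ⇒ Δ)
⊨ˢ-∧ˡ = mk⇔ (λ { h (a ∷ b ∷ γ) → h (from ⊨-∧ (a , b) ∷ γ) })
            (λ { h (ab ∷ γ) → let a , b = to ⊨-∧ ab in h (a ∷ b ∷ γ) })

⊨ˢ-∧ʳ : ∀ {v A B Γ Δ} → v ⊨ˢ (Γ ⇒ A ∧' B ∷ Δ) ⇔ (v ⊨ˢ (Γ ⇒ A ∷ Δ) × v ⊨ˢ (Γ ⇒ B ∷ Δ))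
⊨ˢ-∧ʳ = mk⇔ (λ h → Any-mapʰ (proj₁ ∘ to ⊨-∧) ∘ h , Any-mapʰ (proj₂ ∘ to ⊨-∧) ∘ h)
            (λ { (h , k) γ → Any-zipʰ (λ a b → from ⊨-∧ (a , b)) (h γ) (k γ) })

⊨ˢ-∨ˡ : ∀ {v A B Γ Δ} → v ⊨ˢ (A ∨' B ∷ Γ ⇒ Δ) ⇔ (v ⊨ˢ (A ∷ Γ ⇒ Δ) × v ⊨ˢ (B ∷ Γ ⇒ Δ))
⊨ˢ-∨ˡ = mk⇔ (λ h → (λ { (a ∷ γ) → h (from ⊨-∨ (inj₁ a) ∷ γ) })
                , (λ { (b ∷ γ) → h (from ⊨-∨ (inj₂ b) ∷ γ) }))
            (λ { (h , k) (ab ∷ γ) → [ (λ a → h (a ∷ γ)) , (λ b → k (b ∷ γ)) ]′ (to ⊨-∨ ab) })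

⊨ˢ-∨ʳ : ∀ {v A B Γ Δ} → v ⊨ˢ (Γ ⇒ A ∨' B ∷ Δ) ⇔ v ⊨ˢ (Γ ⇒ A ∷ B ∷ Δ)
⊨ˢ-∨ʳ = mk⇔
  (λ h γ → case h γ of λ
    { (here ab) → [ here , there ∘ here ]′ (to ⊨-∨ ab) ; (there δ) → there (there δ) })
  (λ h γ → case h γ of λ
    { (here a) → here (from ⊨-∨ (inj₁ a)) ; (there (here b)) → here (from ⊨-∨ (inj₂ b))
    ; (there (there δ)) → there δ })

⊨ˢ-⇒ˡ : ∀ {v A B Γ Δ} → v ⊨ˢ (A ⇒' B ∷ Γ ⇒ Δ) ⇔ (v ⊨ˢ (Γ ⇒ A ∷ Δ) × v ⊨ˢ (B ∷ Γ ⇒ Δ))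
⊨ˢ-⇒ˡ {v} {A} = mk⇔
  (λ h → (λ γ → case v ⊨? A of λ
           { (yes a) → here a ; (no na) → there (h (from ⊨-⇒ (⊥-elim ∘ na) ∷ γ)) })
       , (λ { (b ∷ γ) → h (from ⊨-⇒ (λ _ → b) ∷ γ) }))
  (λ { (h , k) (f ∷ γ) → case h γ of λ { (here a) → k (to ⊨-⇒ f a ∷ γ) ; (there δ) → δ } })

⊨ˢ-⇒ʳ : ∀ {v A B Γ Δ} → v ⊨ˢ (Γ ⇒ A ⇒' B ∷ Δ) ⇔ v ⊨ˢ (A ∷ Γ ⇒ B ∷ Δ)
⊨ˢ-⇒ʳ {v} {A} = mk⇔
  (λ { h (a ∷ γ) → Any-mapʰ (λ f → to ⊨-⇒ f a) (h γ) })
  (λ h γ → case v ⊨? A of λ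
    { (yes a) → Any-mapʰ (λ b → from ⊨-⇒ λ _ → b) (h (a ∷ γ))
    ; (no na) → here (from ⊨-⇒ (⊥-elim ∘ na)) })

_⇛_ : List Fm → Fm → Fm
[]       ⇛ C = C
(H ∷ Hs) ⇛ C = H ⇒' (Hs ⇛ C)

⊨-⇛ : ∀ {v} Hs {C} → (All (v ⊨_) Hs → v ⊨ C) → v ⊨ (Hs ⇛ C)
⊨-⇛ []       f = f []
⊨-⇛ (H ∷ Hs) f = from ⊨-⇒ (λ h → ⊨-⇛ Hs (f ∘ (h ∷_)))

_⊫_ : List Fm → Fm → Set
Hs ⊫ C = ∀ {v} → All (v ⊨_) Hs → v ⊨ C

⊫-taut : ∀ Hs {C} → Hs ⊫ C → Taut (Hs ⇛ C)
⊫-taut Hs e v = to T-≡ (holds (⊨-⇛ Hs e))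

module Soundness (𝔇 : Description) where
  open Description 𝔇
  open import Data.List.Membership.DecPropositional ℕ._≟_ using (_∈?_)

  -- Weakening may bring formulas
  -- outside the language of N into an end-active derivation, so soundness is proved for L⁺ and
  -- transported to L by prune, which replaces every □ᵢ with i ∉ N by ⊤.
  data L⁺ : Fm → Set where
    taut⁺  : ∀ {A} → Taut A → L⁺ A
    axK⁺   : ∀ {i A B} → L⁺ (□ i (A ⇒' B) ⇒' (□ i A ⇒' □ i B))
    axD⁺   : ∀ {i} → i ∈ N → F i AxD ≡ true → L⁺ (¬' □ i ⊥')
    axT⁺   : ∀ {i A} → i ∈ N → F i AxT ≡ true → L⁺ (□ i A ⇒' A)
    ax4⁺   : ∀ {i A} → i ∈ N → F i Ax4 ≡ true → L⁺ (□ i A ⇒' □ i (□ i A))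
    axInc⁺ : ∀ {i j A} → i ∈ N → j ∈ N → i ⪯ j → L⁺ (□ j A ⇒' □ i A)
    mp⁺    : ∀ {A B} → L⁺ (A ⇒' B) → L⁺ A → L⁺ B
    nec⁺   : ∀ {i A} → L⁺ A → L⁺ (□ i A)

  consequence : ∀ {Hs C} → Hs ⊫ C → All L⁺ Hs → L⁺ C
  consequence {Hs} e = mp* (taut⁺ (⊫-taut Hs e))
    where
    mp* : ∀ {Hs C} → L⁺ (Hs ⇛ C) → All L⁺ Hs → L⁺ C
    mp* dr []       = dr
    mp* dr (h ∷ hs) = mp* (mp⁺ dr h) hs

  sequent-axiom : ∀ {s} → Valid s → L⁺ ⌜ s ⌝
  sequent-axiom {s} e = consequence (λ _ → from (⊨-⌜⌝ s) e) []

  sequent-rule : ∀ {Hs s s'} → (∀ {v} → All (v ⊨_) Hs → v ⊨ˢ s → v ⊨ˢ s') →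
                 All L⁺ Hs → L⁺ (⌜ s ⌝ ⇒' ⌜ s' ⌝)
  sequent-rule {s = s} {s'} e = consequence (λ hs → from ⊨-⇒ (from (⊨-⌜⌝ s') ∘ e hs ∘ to (⊨-⌜⌝ s)))

  sequent-rule₂ : ∀ {s₁ s₂ s} → (∀ {v} → v ⊨ˢ s₁ → v ⊨ˢ s₂ → v ⊨ˢ s) →
                  L⁺ (⌜ s₁ ⌝ ⇒' (⌜ s₂ ⌝ ⇒' ⌜ s ⌝))
  sequent-rule₂ {s₁} {s₂} {s} e = consequence (λ _ → from ⊨-⇒ λ h₁ → from ⊨-⇒ λ h₂ →
    from (⊨-⌜⌝ s) (e (to (⊨-⌜⌝ s₁) h₁) (to (⊨-⌜⌝ s₂) h₂))) []

  record Regular (f : Fm → Fm) : Set where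
    field
      necessitate : ∀ {X} → L⁺ X → L⁺ (f X)
      distrib : ∀ {X Y} → L⁺ (f (X ⇒' Y) ⇒' (f X ⇒' f Y))

    mono : ∀ {X Y} → L⁺ (X ⇒' Y) → L⁺ (f X ⇒' f Y)
    mono dr = mp⁺ distrib (necessitate dr)

    mono₂ : ∀ {X Y Z} → L⁺ (X ⇒' (Y ⇒' Z)) → L⁺ (f X ⇒' (f Y ⇒' f Z))
    mono₂ dr = consequence
      (λ { (h ∷ k ∷ []) → from ⊨-⇒ (to ⊨-⇒ k ∘ to ⊨-⇒ h) })
      (mono dr ∷ distrib ∷ [])

  open Regular

  id-regular : Regular id
  id-regular = record
    { necessitate = id
    ; distrib = consequence (λ [] → from ⊨-⇒ id) [] }

  □-regular : ∀ k → Regular (□ k)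
  □-regular k = record { necessitate = nec⁺ ; distrib = axK⁺ }

  ∘-regular : ∀ {f g} → Regular f → Regular g → Regular (f ∘ g)
  ∘-regular F G = record
    { necessitate = necessitate F ∘ necessitate G
    ; distrib = consequence
        (λ { (h ∷ k ∷ []) → from ⊨-⇒ (to ⊨-⇒ k ∘ to ⊨-⇒ h) })
        (mono F (distrib G) ∷ distrib F ∷ []) }

  infixl 5 _▷_
  _▷_ : Seq → Fm → Seq
  (Γ ⇒ Δ) ▷ X = Γ ⇒ X ∷ Δ

  ▷-regular : ∀ s → Regular (λ X → ⌜ s ▷ X ⌝)
  ▷-regular s = record
    { necessitate = λ dr → consequence (λ { (x ∷ []) → from (⊨-⌜⌝ (s ▷ _)) (λ _ → here x) })
                                       (dr ∷ [])
    ; distrib     = sequent-rule₂ (λ h k γ → Any-zipʰ (to ⊨-⇒) (h γ) (k γ)) }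

  -- Splitting P,
  -- ι (P ⊳ s) ≡ ⟦ P ⟧ ⌜ s ⌝ and ⟦ P ⊳ s ⟧ᴸ X ≡ ⟦ P ⟧ ⌜ s ▷ X ⌝ hold by definition; the lift lemmas
  -- below do nothing else.
  ⟦_⟧ᴸ : LNS → Fm → Fm
  ⟦ one s ⟧ᴸ      X = ⌜ s ▷ X ⌝
  ⟦ G /[ k ] s ⟧ᴸ X = ⟦ G ⟧ᴸ (□ k ⌜ s ▷ X ⌝)

  ⟦_⟧ : Pre → Fm → Fm
  ⟦ ε ⟧        X = X
  ⟦ G /⟨ k ⟩ ⟧ X = ⟦ G ⟧ᴸ (□ k X)

  ι : LNS → Fm
  ι (one s)      = ⌜ s ⌝
  ι (G /[ k ] s) = ⟦ G /⟨ k ⟩ ⟧ ⌜ s ⌝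

  ⟦⟧ᴸ-regular : ∀ G → Regular ⟦ G ⟧ᴸ
  ⟦⟧ᴸ-regular (one s)      = ▷-regular s
  ⟦⟧ᴸ-regular (G /[ k ] s) = ∘-regular (⟦⟧ᴸ-regular G) (∘-regular (□-regular k) (▷-regular s))

  ⟦⟧-regular : ∀ P → Regular ⟦ P ⟧
  ⟦⟧-regular ε          = id-regular
  ⟦⟧-regular (G /⟨ k ⟩) = ∘-regular (⟦⟧ᴸ-regular G) (□-regular k)

  lift₀ : ∀ P {s} → L⁺ ⌜ s ⌝ → L⁺ (ι (P ⊳ s))
  lift₀ ε          = id
  lift₀ (G /⟨ k ⟩) = necessitate (⟦⟧-regular (G /⟨ k ⟩))

  lift₀ᴸ : ∀ P {s X} → L⁺ ⌜ s ▷ X ⌝ → L⁺ (⟦ P ⊳ s ⟧ᴸ X)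
  lift₀ᴸ ε          = id
  lift₀ᴸ (G /⟨ k ⟩) = necessitate (⟦⟧-regular (G /⟨ k ⟩))

  lift₁ : ∀ P {s s'} → L⁺ (⌜ s ⌝ ⇒' ⌜ s' ⌝) → L⁺ (ι (P ⊳ s)) → L⁺ (ι (P ⊳ s'))
  lift₁ ε          = mp⁺
  lift₁ (G /⟨ k ⟩) = mp⁺ ∘ mono (⟦⟧-regular (G /⟨ k ⟩))

  lift₁ᴸ : ∀ P {s s' X X'} → L⁺ (⌜ s ▷ X ⌝ ⇒' ⌜ s' ▷ X' ⌝) → L⁺ (⟦ P ⊳ s ⟧ᴸ X) → L⁺ (⟦ P ⊳ s' ⟧ᴸ X')
  lift₁ᴸ ε          = mp⁺
  lift₁ᴸ (G /⟨ k ⟩) = mp⁺ ∘ mono (⟦⟧-regular (G /⟨ k ⟩))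

  lift₁↓ : ∀ P {s X s'} → L⁺ (⌜ s ▷ X ⌝ ⇒' ⌜ s' ⌝) → L⁺ (⟦ P ⊳ s ⟧ᴸ X) → L⁺ (ι (P ⊳ s'))
  lift₁↓ ε          = mp⁺
  lift₁↓ (G /⟨ k ⟩) = mp⁺ ∘ mono (⟦⟧-regular (G /⟨ k ⟩))

  lift₂ : ∀ P {s₁ s₂ s} → L⁺ (⌜ s₁ ⌝ ⇒' (⌜ s₂ ⌝ ⇒' ⌜ s ⌝)) →
          L⁺ (ι (P ⊳ s₁)) → L⁺ (ι (P ⊳ s₂)) → L⁺ (ι (P ⊳ s))
  lift₂ ε          c = mp⁺ ∘ mp⁺ c
  lift₂ (G /⟨ k ⟩) c = mp⁺ ∘ mp⁺ (mono₂ (⟦⟧-regular (G /⟨ k ⟩)) c)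

  ≈-mono : ∀ {G G'} → G ≈ G' → ∀ {X Y} → L⁺ (X ⇒' Y) → L⁺ (⟦ G ⟧ᴸ X ⇒' ⟦ G' ⟧ᴸ Y)
  ≈-mono (one≈ p q)   c =
    sequent-rule (λ { (f ∷ []) h → ⊨ˢ-resp-↭ p (prep _ q) (Any-mapʰ (to ⊨-⇒ f) ∘ h) }) (c ∷ [])
  ≈-mono (ext≈ g p q) c = ≈-mono g (mono (□-regular _) (≈-mono (one≈ p q) c))

  sound-≈ : ∀ {S S'} → S ≈ S' → L⁺ (ι S) → L⁺ (ι S')
  sound-≈ (one≈ p q)   = mp⁺ (sequent-rule (λ _ → ⊨ˢ-resp-↭ p q) [])
  sound-≈ (ext≈ g p q) = mp⁺ (≈-mono g (mono (□-regular _) (sequent-rule (λ _ → ⊨ˢ-resp-↭ p q) [])))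

  box-left : ∀ {U j B Γ Δ Σ Π} → L⁺ (U ⇒' □ j B) →
             L⁺ (⌜ (Γ ⇒ Δ) ▷ □ j ⌜ B ∷ Σ ⇒ Π ⌝ ⌝ ⇒' ⌜ (U ∷ Γ ⇒ Δ) ▷ □ j ⌜ Σ ⇒ Π ⌝ ⌝)
  box-left {Σ = Σ} {Π} u = sequent-rule
    (λ { (u ∷ k ∷ []) h (x ∷ γ) → Any-mapʰ (to ⊨-⇒ (to ⊨-⇒ k (to ⊨-⇒ u x))) (h γ) })
    (u ∷ mono₂ (□-regular _) modus-ponens ∷ [])
    where
    modus-ponens : ∀ {B} → L⁺ (B ⇒' (⌜ B ∷ Σ ⇒ Π ⌝ ⇒' ⌜ Σ ⇒ Π ⌝))
    modus-ponens {B} = consequence (λ _ → from ⊨-⇒ λ b → from ⊨-⇒ λ h →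
      from (⊨-⌜⌝ (Σ ⇒ Π)) (λ σ → to (⊨-⌜⌝ (B ∷ Σ ⇒ Π)) h (b ∷ σ))) []

  ⌜⇒A⌝-elim : ∀ {A} → L⁺ (⌜ [] ⇒ A ∷ [] ⌝ ⇒' A)
  ⌜⇒A⌝-elim {A} = consequence (λ _ → from ⊨-⇒ λ h → head (to (⊨-⌜⌝ ([] ⇒ A ∷ [])) h [])) []
    where
    head : ∀ {v} → Any (v ⊨_) (A ∷ []) → v ⊨ A
    head (here a) = a

  box-right : ∀ {i A Γ Δ} → L⁺ (⌜ (Γ ⇒ Δ) ▷ □ i ⌜ [] ⇒ A ∷ [] ⌝ ⌝ ⇒' ⌜ Γ ⇒ □ i A ∷ Δ ⌝)
  box-right = sequent-rule (λ { (k ∷ []) h → Any-mapʰ (to ⊨-⇒ k) ∘ h })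
                           (mono (□-regular _) ⌜⇒A⌝-elim ∷ [])

  ¬□⊥ : ∀ {j} → j ∈ N → KD⊆ 𝔇 j → L⁺ (¬' □ j ⊥')
  ¬□⊥ jN (inj₁ kd) = axD⁺ jN kd
  ¬□⊥ jN (inj₂ kt) =
    consequence (λ { (f ∷ []) → from ⊨-¬ (holds ∘ to ⊨-⇒ f) }) (axT⁺ jN kt ∷ [])

  box-serial : ∀ {i j A Γ Δ} → i ∈ N → j ∈ N → j ⪯ i → KD⊆ 𝔇 j →
               L⁺ (⌜ (Γ ⇒ Δ) ▷ □ j ⌜ A ∷ [] ⇒ [] ⌝ ⌝ ⇒' ⌜ □ i A ∷ Γ ⇒ Δ ⌝)
  box-serial {A = A} iN jN ji kd = sequent-rule
    (λ { (inc ∷ k ∷ nb ∷ []) h (a ∷ γ) →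
           Any.tail (λ x → to ⊨-¬ nb (to ⊨-⇒ (to ⊨-⇒ k (to ⊨-⇒ inc a)) x)) (h γ) })
    (axInc⁺ jN iN ji ∷ mono₂ (□-regular _) contradictory ∷ ¬□⊥ jN kd ∷ [])
    where
    contradictory : L⁺ (A ⇒' (⌜ A ∷ [] ⇒ [] ⌝ ⇒' ⊥'))
    contradictory = consequence (λ _ → from ⊨-⇒ λ a → from ⊨-⇒ λ h →
      ⊥-elim (Any-empty (to (⊨-⌜⌝ (A ∷ [] ⇒ [])) h (a ∷ [])))) []
      where
      Any-empty : ∀ {v} → ¬ Any (v ⊨_) []
      Any-empty ()

  sound : ∀ {S} → EA 𝔇 S → L⁺ (ι S)
  sound (perm e D) = sound-≈ e (sound D)
  sound (init {P})       = lift₀ P (sequent-axiom λ { (p ∷ _) → here p })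
  sound (init' {P} _)    = lift₀ᴸ P (sequent-axiom λ { (p ∷ _) → there (here p) })
  sound (⊥L {P})         = lift₀ P (sequent-axiom λ { (⊨⟨ () ⟩ ∷ _) })
  sound (⊥L' {P} _)      = lift₀ᴸ P (sequent-axiom λ { (⊨⟨ () ⟩ ∷ _) })
  sound (⊤R {P})         = lift₀ P (sequent-axiom λ _ → here _)
  sound (⊤R' {P} _)      = lift₀ᴸ P (sequent-axiom λ _ → there (here _))
  sound (¬L {P} D) = lift₁ P (sequent-rule (λ _ → from ⊨ˢ-¬ˡ) []) (sound D)
  sound (¬R {P} D) = lift₁ P (sequent-rule (λ _ → from ⊨ˢ-¬ʳ) []) (sound D)
  sound (∧L {P} D) = lift₁ P (sequent-rule (λ _ → from ⊨ˢ-∧ˡ) []) (sound D)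
  sound (∧R {P} D E) = lift₂ P (sequent-rule₂ λ h k → from ⊨ˢ-∧ʳ (h , k)) (sound D) (sound E)
  sound (∨L {P} D E) = lift₂ P (sequent-rule₂ λ h k → from ⊨ˢ-∨ˡ (h , k)) (sound D) (sound E)
  sound (∨R {P} D) = lift₁ P (sequent-rule (λ _ → from ⊨ˢ-∨ʳ) []) (sound D)
  sound (⇒L {P} D E) = lift₂ P (sequent-rule₂ λ h k → from ⊨ˢ-⇒ˡ (h , k)) (sound D) (sound E)
  sound (⇒R {P} D) = lift₁ P (sequent-rule (λ _ → from ⊨ˢ-⇒ʳ) []) (sound D)
  sound (conL {P} D) = lift₁ P (sequent-rule (λ { _ h (a ∷ γ) → h (a ∷ a ∷ γ) }) []) (sound D)
  sound (conR {P} D) = lift₁ P (sequent-rule (λ _ h γ → case h γ of λ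
    { (here a) → here a ; (there δ) → δ }) []) (sound D)
  sound (wkL {P} D) = lift₁ P (sequent-rule (λ { _ h (_ ∷ γ) → h γ }) []) (sound D)
  sound (wkR {P} D) = lift₁ P (sequent-rule (λ _ h → there ∘ h) []) (sound D)
  sound (□L {P} iN jN ji D) = lift₁ᴸ P (box-left (axInc⁺ jN iN ji)) (sound D)
  sound (f4 {P} iN jN ji k4 D) =
    lift₁ᴸ P (box-left (consequence (λ { (f ∷ g ∷ []) → from ⊨-⇒ (to ⊨-⇒ g ∘ to ⊨-⇒ f) })
                                    (ax4⁺ iN k4 ∷ axInc⁺ jN iN ji ∷ []))) (sound D)
  sound (□R {P} _ D) = lift₁↓ P box-right (sound D)
  sound (d {P} iN jN ji kd D) = lift₁↓ P (box-serial iN jN ji kd) (sound D)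
  sound (t {P} iN kt D) = lift₁ P (sequent-rule (λ { (f ∷ []) h (a ∷ γ) → h (to ⊨-⇒ f a ∷ γ) })
                                                (axT⁺ iN kt ∷ [])) (sound D)

  prune : Fm → Fm
  prune (var p)  = var p
  prune ⊥'       = ⊥'
  prune ⊤'       = ⊤'
  prune (¬' A)   = ¬' prune A
  prune (A ∧' B) = prune A ∧' prune B
  prune (A ∨' B) = prune A ∨' prune B
  prune (A ⇒' B) = prune A ⇒' prune B
  prune (□ i A) with i ∈? N
  ... | yes _ = □ i (prune A)
  ... | no _  = ⊤'

  prune-WF : ∀ A → WF N (prune A)
  prune-WF (var p)  = wf-var
  prune-WF ⊥'       = wf-⊥
  prune-WF ⊤'       = wf-⊤
  prune-WF (¬' A)   = wf-¬ (prune-WF A)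
  prune-WF (A ∧' B) = wf-∧ (prune-WF A) (prune-WF B)
  prune-WF (A ∨' B) = wf-∨ (prune-WF A) (prune-WF B)
  prune-WF (A ⇒' B) = wf-⇒ (prune-WF A) (prune-WF B)
  prune-WF (□ i A) with i ∈? N
  ... | yes iN = wf-□ iN (prune-WF A)
  ... | no _   = wf-⊤

  prune-□ : ∀ {i A} → i ∈ N → prune (□ i A) ≡ □ i (prune A)
  prune-□ {i} iN with i ∈? N
  ... | yes _  = refl
  ... | no i∉N = ⊥-elim (i∉N iN)

  prune-id : ∀ {A} → WF N A → prune A ≡ A
  prune-id wf-var       = refl
  prune-id wf-⊥         = refl
  prune-id wf-⊤         = refl
  prune-id (wf-¬ w)     = cong ¬'_ (prune-id w)
  prune-id (wf-∧ w u)   = cong₂ _∧'_ (prune-id w) (prune-id u)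
  prune-id (wf-∨ w u)   = cong₂ _∨'_ (prune-id w) (prune-id u)
  prune-id (wf-⇒ w u)   = cong₂ _⇒'_ (prune-id w) (prune-id u)
  prune-id (wf-□ iN w)  = trans (prune-□ iN) (cong (□ _) (prune-id w))

  eval-prune : ∀ v A → eval v (prune A) ≡ eval (eval v ∘ prune) A
  eval-prune v (var p)  = refl
  eval-prune v ⊥'       = refl
  eval-prune v ⊤'       = refl
  eval-prune v (¬' A)   = cong not (eval-prune v A)
  eval-prune v (A ∧' B) = cong₂ _∧_ (eval-prune v A) (eval-prune v B)
  eval-prune v (A ∨' B) = cong₂ _∨_ (eval-prune v A) (eval-prune v B)
  eval-prune v (A ⇒' B) = cong₂ (λ a b → not a ∨ b) (eval-prune v A) (eval-prune v B)
  eval-prune v (□ i A)  = refl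

  prune-L : ∀ {A} → L⁺ A → L 𝔇 (prune A)
  prune-L (taut⁺ {A} τ) = taut (prune-WF A) (λ v → trans (eval-prune v A) (τ _))
  prune-L (axK⁺ {i} {A} {B}) with i ∈? N
  ... | yes iN = axK iN (prune-WF A) (prune-WF B)
  ... | no _   = taut (wf-⇒ wf-⊤ (wf-⇒ wf-⊤ wf-⊤)) (λ _ → refl)
  prune-L (axD⁺ iN kd) rewrite prune-□ {A = ⊥'} iN = axD iN kd
  prune-L (axT⁺ {A = A} iN kt) rewrite prune-□ {A = A} iN = axT iN (prune-WF A) kt
  prune-L (ax4⁺ {i} {A} iN k4) rewrite prune-□ {A = □ i A} iN | prune-□ {A = A} iN =
    ax4 iN (prune-WF A) k4
  prune-L (axInc⁺ {A = A} iN jN ij) rewrite prune-□ {A = A} iN | prune-□ {A = A} jN =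
    axInc iN jN (prune-WF A) ij
  prune-L (mp⁺ dr₁ dr₂) = mp (prune-L dr₁) (prune-L dr₂)
  prune-L (nec⁺ {i} dr) with i ∈? N
  ... | yes iN = nec iN (prune-L dr)
  ... | no _   = taut wf-⊤ (λ _ → refl)

  soundness : ∀ {A} → WF N A → EA 𝔇 (one ([] ⇒ A ∷ [])) → L 𝔇 A
  soundness {A} w D = subst (L 𝔇) (prune-id w) (prune-L (mp⁺ ⌜⇒A⌝-elim (sound D)))

swap⊆ : ∀ {A B : Fm} {Γ} → A ∷ B ∷ Γ ⊆ B ∷ A ∷ Γ
swap⊆ (here p)         = there (here p)
swap⊆ (there (here p)) = here p
swap⊆ (there (there p)) = there (there p)

rotate⊆ : ∀ {A B C : Fm} {Γ} → A ∷ B ∷ C ∷ Γ ⊆ C ∷ A ∷ B ∷ Γ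
rotate⊆ (here p)                 = there (here p)
rotate⊆ (there (here p))         = there (there (here p))
rotate⊆ (there (there (here p))) = here p
rotate⊆ (there (there (there p))) = there (there (there p))

there² : ∀ {A B : Fm} {Γ} → Γ ⊆ A ∷ B ∷ Γ
there² = there ∘′ there

[A]⊆A∷Δ : ∀ {A : Fm} {Δ} → A ∷ [] ⊆ A ∷ Δ
[A]⊆A∷Δ = ∷⁺ʳ _ (λ ())

NotBox : Fm → Set
NotBox (□ _ _) = ⊥
NotBox _       = ⊤

module Calculus (𝔇 : Description) where
  open Description 𝔇

  data Unbox (k : ℕ) (B : Fm) : Fm → Set where
    strip : Unbox k B B
    keep  : K4⊆ 𝔇 k → Unbox k B (□ k B)

  data Transfer (j : ℕ) (Γ : List Fm) (X : Fm) : Set where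
    transfer : ∀ {k B} → □ k B ∈ Γ → k ∈ N → j ⪯ k → Unbox k B X → Transfer j Γ X

  Transfers : ℕ → List Fm → List Fm → Set
  Transfers j Γ = All (Transfer j Γ)

  Transfers-mono : ∀ {j Γ Γ' Θ} → Γ ⊆ Γ' → Transfers j Γ Θ → Transfers j Γ' Θ
  Transfers-mono s = All.map λ { (transfer m kN jk u) → transfer (s m) kN jk u }

  Transfers-⪯ : ∀ {i j Γ Θ} → j ∈ N → i ∈ N → j ⪯ i → Transfers i Γ Θ → Transfers j Γ Θ
  Transfers-⪯ jN iN ji =
    All.map λ { (transfer m kN ik u) → transfer m kN (⪯-trans jN iN kN ji ik) u }

  infix 3 _⊢[_]_ _⊢_

  -- Contexts are read as sets: principal formulas stay in the premisses. The index bounds the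
  -- height and drives the termination of cut elimination.
  data _⊢[_]_ : List Fm → ℕ → List Fm → Set where
    ax  : ∀ {n Γ Δ p} → var p ∈ Γ → var p ∈ Δ → Γ ⊢[ n ] Δ
    ⊥ˡ  : ∀ {n Γ Δ} → ⊥' ∈ Γ → Γ ⊢[ n ] Δ
    ⊤ʳ  : ∀ {n Γ Δ} → ⊤' ∈ Δ → Γ ⊢[ n ] Δ
    ¬ˡ  : ∀ {n Γ Δ A} → ¬' A ∈ Γ → Γ ⊢[ n ] A ∷ Δ → Γ ⊢[ suc n ] Δ
    ¬ʳ  : ∀ {n Γ Δ A} → ¬' A ∈ Δ → A ∷ Γ ⊢[ n ] Δ → Γ ⊢[ suc n ] Δ
    ∧ˡ  : ∀ {n Γ Δ A B} → A ∧' B ∈ Γ → A ∷ B ∷ Γ ⊢[ n ] Δ → Γ ⊢[ suc n ] Δ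
    ∧ʳ  : ∀ {n Γ Δ A B} → A ∧' B ∈ Δ → Γ ⊢[ n ] A ∷ Δ → Γ ⊢[ n ] B ∷ Δ → Γ ⊢[ suc n ] Δ
    ∨ˡ  : ∀ {n Γ Δ A B} → A ∨' B ∈ Γ → A ∷ Γ ⊢[ n ] Δ → B ∷ Γ ⊢[ n ] Δ → Γ ⊢[ suc n ] Δ
    ∨ʳ  : ∀ {n Γ Δ A B} → A ∨' B ∈ Δ → Γ ⊢[ n ] A ∷ B ∷ Δ → Γ ⊢[ suc n ] Δ
    ⇒ˡ  : ∀ {n Γ Δ A B} → A ⇒' B ∈ Γ → Γ ⊢[ n ] A ∷ Δ → B ∷ Γ ⊢[ n ] Δ → Γ ⊢[ suc n ] Δ
    ⇒ʳ  : ∀ {n Γ Δ A B} → A ⇒' B ∈ Δ → A ∷ Γ ⊢[ n ] B ∷ Δ → Γ ⊢[ suc n ] Δ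
    tˡ  : ∀ {n Γ Δ A i} → □ i A ∈ Γ → i ∈ N → KT⊆ 𝔇 i → A ∷ Γ ⊢[ n ] Δ → Γ ⊢[ suc n ] Δ
    □ʳ  : ∀ {n Γ Δ A i Θ} → □ i A ∈ Δ → i ∈ N → Transfers i Γ Θ → Θ ⊢[ n ] A ∷ [] →
          Γ ⊢[ suc n ] Δ
    dᴳ  : ∀ {n Γ Δ j Θ} → j ∈ N → KD⊆ 𝔇 j → Transfers j Γ Θ → Θ ⊢[ n ] [] → Γ ⊢[ suc n ] Δ

  _⊢_ : List Fm → List Fm → Set
  Γ ⊢ Δ = ∃[ n ] Γ ⊢[ n ] Δ

  weaken : ∀ {n Γ Δ Γ' Δ'} → Γ ⊢[ n ] Δ → Γ ⊆ Γ' → Δ ⊆ Δ' → Γ' ⊢[ n ] Δ'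
  weaken (ax p q)          s u = ax (s p) (u q)
  weaken (⊥ˡ p)            s u = ⊥ˡ (s p)
  weaken (⊤ʳ p)            s u = ⊤ʳ (u p)
  weaken (¬ˡ p D)          s u = ¬ˡ (s p) (weaken D s (∷⁺ʳ _ u))
  weaken (¬ʳ p D)          s u = ¬ʳ (u p) (weaken D (∷⁺ʳ _ s) u)
  weaken (∧ˡ p D)          s u = ∧ˡ (s p) (weaken D (∷⁺ʳ _ (∷⁺ʳ _ s)) u)
  weaken (∧ʳ p D E)        s u = ∧ʳ (u p) (weaken D s (∷⁺ʳ _ u)) (weaken E s (∷⁺ʳ _ u))
  weaken (∨ˡ p D E)        s u = ∨ˡ (s p) (weaken D (∷⁺ʳ _ s) u) (weaken E (∷⁺ʳ _ s) u)
  weaken (∨ʳ p D)          s u = ∨ʳ (u p) (weaken D s (∷⁺ʳ _ (∷⁺ʳ _ u)))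
  weaken (⇒ˡ p D E)        s u = ⇒ˡ (s p) (weaken D s (∷⁺ʳ _ u)) (weaken E (∷⁺ʳ _ s) u)
  weaken (⇒ʳ p D)          s u = ⇒ʳ (u p) (weaken D (∷⁺ʳ _ s) (∷⁺ʳ _ u))
  weaken (tˡ p iN kt D)    s u = tˡ (s p) iN kt (weaken D (∷⁺ʳ _ s) u)
  weaken (□ʳ p iN ts D)    s u = □ʳ (u p) iN (Transfers-mono s ts) D
  weaken (dᴳ jN kd ts D)   s u = dᴳ jN kd (Transfers-mono s ts) D

  weaken' : ∀ {Γ Δ Γ' Δ'} → Γ ⊢ Δ → Γ ⊆ Γ' → Δ ⊆ Δ' → Γ' ⊢ Δ'
  weaken' (n , D) s u = n , weaken D s u

  raise : ∀ {n Γ Δ} → Γ ⊢[ n ] Δ → Γ ⊢[ suc n ] Δ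
  raise (ax p q)        = ax p q
  raise (⊥ˡ p)          = ⊥ˡ p
  raise (⊤ʳ p)          = ⊤ʳ p
  raise (¬ˡ p D)        = ¬ˡ p (raise D)
  raise (¬ʳ p D)        = ¬ʳ p (raise D)
  raise (∧ˡ p D)        = ∧ˡ p (raise D)
  raise (∧ʳ p D E)      = ∧ʳ p (raise D) (raise E)
  raise (∨ˡ p D E)      = ∨ˡ p (raise D) (raise E)
  raise (∨ʳ p D)        = ∨ʳ p (raise D)
  raise (⇒ˡ p D E)      = ⇒ˡ p (raise D) (raise E)
  raise (⇒ʳ p D)        = ⇒ʳ p (raise D)
  raise (tˡ p iN kt D)  = tˡ p iN kt (raise D)
  raise (□ʳ p iN ts D)  = □ʳ p iN ts (raise D)
  raise (dᴳ jN kd ts D) = dᴳ jN kd ts (raise D)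

  raise≤ : ∀ {n m Γ Δ} → n ≤ m → Γ ⊢[ n ] Δ → Γ ⊢[ m ] Δ
  raise≤ n≤m = go (≤⇒≤′ n≤m)
    where
    go : ∀ {n m Γ Δ} → n ≤′ m → Γ ⊢[ n ] Δ → Γ ⊢[ m ] Δ
    go ≤′-refl        D = D
    go (≤′-step n≤′m) D = raise (go n≤′m D)

  by₁ : ∀ {Γ₁ Δ₁ Γ Δ} → (∀ {n} → Γ₁ ⊢[ n ] Δ₁ → Γ ⊢[ suc n ] Δ) → Γ₁ ⊢ Δ₁ → Γ ⊢ Δ
  by₁ r (n , D) = suc n , r D

  by₂ : ∀ {Γ₁ Δ₁ Γ₂ Δ₂ Γ Δ} → (∀ {n} → Γ₁ ⊢[ n ] Δ₁ → Γ₂ ⊢[ n ] Δ₂ → Γ ⊢[ suc n ] Δ) →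
        Γ₁ ⊢ Δ₁ → Γ₂ ⊢ Δ₂ → Γ ⊢ Δ
  by₂ r (n₁ , D₁) (n₂ , D₂) =
    suc (n₁ ⊔ n₂) , r (raise≤ (m≤m⊔n n₁ n₂) D₁) (raise≤ (m≤n⊔m n₁ n₂) D₂)

  by□ : ∀ {Γ Δ Ω} {Side : List Fm → Set} → (∀ {n Θ} → Side Θ → Θ ⊢[ n ] Ω → Γ ⊢[ suc n ] Δ) →
        ∃[ Θ ] (Side Θ × Θ ⊢ Ω) → Γ ⊢ Δ
  by□ r (Θ , side , (n , D)) = suc n , r side D

  Transfers-drop : ∀ {A j Γ Θ} → NotBox A → Transfers j (A ∷ Γ) Θ → Transfers j Γ Θ
  Transfers-drop nb [] = []
  Transfers-drop nb (transfer (here refl) kN jk u ∷ ts) = ⊥-elim nb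
  Transfers-drop nb (transfer (there m) kN jk u ∷ ts) = transfer m kN jk u ∷ Transfers-drop nb ts

  data RightIntro : ℕ → List Fm → List Fm → Fm → Set where
    ⊤ᴾ : ∀ {n Γ Δ} → RightIntro n Γ Δ ⊤'
    ¬ᴾ : ∀ {n Γ Δ A} → A ∷ Γ ⊢[ n ] ¬' A ∷ Δ → RightIntro (suc n) Γ Δ (¬' A)
    ∧ᴾ : ∀ {n Γ Δ A B} → Γ ⊢[ n ] A ∷ A ∧' B ∷ Δ → Γ ⊢[ n ] B ∷ A ∧' B ∷ Δ →
         RightIntro (suc n) Γ Δ (A ∧' B)
    ∨ᴾ : ∀ {n Γ Δ A B} → Γ ⊢[ n ] A ∷ B ∷ A ∨' B ∷ Δ → RightIntro (suc n) Γ Δ (A ∨' B)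
    ⇒ᴾ : ∀ {n Γ Δ A B} → A ∷ Γ ⊢[ n ] B ∷ A ⇒' B ∷ Δ → RightIntro (suc n) Γ Δ (A ⇒' B)
    □ᴾ : ∀ {n Γ Δ A i Θ} → i ∈ N → Transfers i Γ Θ → Θ ⊢[ n ] A ∷ [] →
         RightIntro (suc n) Γ Δ (□ i A)

  weakenᴾ : ∀ {n Γ Δ Γ' Δ' A} → RightIntro n Γ Δ A → Γ ⊆ Γ' → Δ ⊆ Δ' → RightIntro n Γ' Δ' A
  weakenᴾ ⊤ᴾ             s u = ⊤ᴾ
  weakenᴾ (¬ᴾ D)         s u = ¬ᴾ (weaken D (∷⁺ʳ _ s) (∷⁺ʳ _ u))
  weakenᴾ (∧ᴾ D₁ D₂)     s u = ∧ᴾ (weaken D₁ s (∷⁺ʳ _ (∷⁺ʳ _ u))) (weaken D₂ s (∷⁺ʳ _ (∷⁺ʳ _ u)))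
  weakenᴾ (∨ᴾ D)         s u = ∨ᴾ (weaken D s (∷⁺ʳ _ (∷⁺ʳ _ (∷⁺ʳ _ u))))
  weakenᴾ (⇒ᴾ D)         s u = ⇒ᴾ (weaken D (∷⁺ʳ _ s) (∷⁺ʳ _ (∷⁺ʳ _ u)))
  weakenᴾ (□ᴾ iN ts D)   s u = □ᴾ iN (Transfers-mono s ts) D


module CutElimination (𝔇 : Description) (tc : TransitiveClosed 𝔇) (sa : StandingAssumption 𝔇) where
  open Description 𝔇
  open Calculus 𝔇

  transfer-boxes : ∀ {i j Γ Θ} → j ∈ N → i ∈ N → j ⪯ i → K4⊆ 𝔇 i → Transfers i Γ Θ →
                   ∃[ Θ□ ] (Transfers j Γ Θ□ × Transfers i Θ□ Θ)
  transfer-boxes jN iN ji k4 [] = [] , [] , []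
  transfer-boxes jN iN ji k4 (transfer {k} {B} m kN ik u ∷ ts) with transfer-boxes jN iN ji k4 ts
  ... | Θ□ , jΘ□ , iΘ =
    □ k B ∷ Θ□ ,
    transfer m kN (⪯-trans jN iN kN ji ik) (keep (tc iN kN ik k4)) ∷ jΘ□ ,
    transfer (here refl) kN ik u ∷ Transfers-mono there iΘ

  data HeadUse (j i : ℕ) (A : Fm) (Θ Θr : List Fm) : Set where
    unused : Θ ⊆ Θr → HeadUse j i A Θ Θr
    used   : j ⪯ i → (∀ {x} → x ∈ Θ → x ∈ Θr ⊎ Unbox i A x) → HeadUse j i A Θ Θr

  split : ∀ {j i A Γ Θ} → Transfers j (□ i A ∷ Γ) Θ →
          ∃[ Θr ] (Transfers j Γ Θr × HeadUse j i A Θ Θr)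
  split [] = [] , [] , unused (λ ())
  split (transfer (here refl) kN jk u ∷ ts) with split ts
  ... | Θr , tr , unused f  = Θr , tr , used jk λ { (here refl) → inj₂ u ; (there p) → inj₁ (f p) }
  ... | Θr , tr , used _ g  = Θr , tr , used jk λ { (here refl) → inj₂ u ; (there p) → g p }
  split {Θ = X ∷ _} (transfer (there m) kN jk u ∷ ts) with split ts
  ... | Θr , tr , unused f  = X ∷ Θr , transfer m kN jk u ∷ tr , unused (∷⁺ʳ X f)
  ... | Θr , tr , used ji g = X ∷ Θr , transfer m kN jk u ∷ tr , used ji λ
    { (here refl) → inj₁ (here refl)
    ; (there p) → Data.Sum.map₁ there (g p) }

  cover : ∀ {i A Θ Θr Θ' Ξ} → (∀ {x} → x ∈ Θ → x ∈ Θr ⊎ Unbox i A x) → Θr ⊆ Θ' →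
          (∀ {x} → Unbox i A x → x ∈ Ξ) → Θ ⊆ Ξ ++ Θ'
  cover {Ξ = Ξ} g s h p with g p
  ... | inj₁ q = ∈-++⁺ʳ Ξ (s q)
  ... | inj₂ u = ∈-++⁺ˡ (h u)

  absorb-T : ∀ {i Γ Θ Δ} → i ∈ N → KT⊆ 𝔇 i → Transfers i Γ Θ → Θ ++ Γ ⊢ Δ → Γ ⊢ Δ
  absorb-T iN kt [] R = R
  absorb-T {Θ = _ ∷ Θ} iN kt (transfer m kN ik strip ∷ ts) R =
    absorb-T iN kt ts (by₁ (tˡ (∈-++⁺ʳ Θ m) kN (proj₂ (sa iN kN ik) kt)) R)
  absorb-T {Θ = _ ∷ Θ} iN kt (transfer m kN ik (keep _) ∷ ts) R =
    absorb-T iN kt ts (weaken' R (λ { (here refl) → ∈-++⁺ʳ Θ m ; (there p) → p }) ⊆-refl)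

  -- How a modal premiss Θ ⊢ Ω over □ i A ∷ Γ is rebuilt over Γ, given □ i A by a □-intro with
  -- premiss of height n: it did not use □ i A; or a cut on A remains; or, when i has axiom 4, a cut
  -- on □ i A against a premiss of lower height remains before the cut on A.
  data Reduct (j i : ℕ) (A : Fm) (n m : ℕ) (Γ Ω : List Fm) : Set where
    unaffected : ∀ {Θ} → Transfers j Γ Θ → Θ ⊢[ m ] Ω → Reduct j i A n m Γ Ω
    via-A      : ∀ {Θ} → Transfers j Γ Θ → Θ ⊢[ n ] A ∷ Ω → A ∷ Θ ⊢[ m ] Ω → Reduct j i A n m Γ Ω
    via-□A     : ∀ {Θ} → Transfers j Γ Θ → Θ ⊢[ n ] A ∷ Ω → RightIntro (suc n) (A ∷ Θ) Ω (□ i A) →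
                 □ i A ∷ A ∷ Θ ⊢[ m ] Ω → Reduct j i A n m Γ Ω

  reduct : ∀ {n m i j A Γ Θ Θ' Ω} → i ∈ N → Transfers i Γ Θ → Θ ⊢[ n ] A ∷ [] →
           j ∈ N → Transfers j (□ i A ∷ Γ) Θ' → Θ' ⊢[ m ] Ω → Reduct j i A n m Γ Ω
  reduct {i = i} {A = A} iN ts D jN ts' E with split ts'
  ... | Θr , tr , unused f = unaffected tr (weaken E f ⊆-refl)
  ... | Θr , tr , used ji g with F i Ax4 Data.Bool.≟ true
  ...   | yes k4 =
    let Θ□ , jΘ□ , iΘ = transfer-boxes jN iN ji k4 ts in
    via-□A (All.++⁺ tr (All.++⁺ (Transfers-⪯ jN iN ji ts) jΘ□))
           (weaken D (∈-++⁺ʳ Θr ∘ ∈-++⁺ˡ) [A]⊆A∷Δ)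
           (□ᴾ iN (Transfers-mono (there ∘ ∈-++⁺ʳ Θr ∘ ∈-++⁺ʳ _) iΘ) D)
           (weaken E (cover g (xs⊆xs++ys Θr _) unboxed∈) ⊆-refl)
    where
    unboxed∈ : ∀ {x} → Unbox i A x → x ∈ □ i A ∷ A ∷ []
    unboxed∈ strip    = there (here refl)
    unboxed∈ (keep _) = here refl
  ...   | no no4 =
    via-A (All.++⁺ tr (Transfers-⪯ jN iN ji ts))
          (weaken D (∈-++⁺ʳ Θr) [A]⊆A∷Δ)
          (weaken E (cover g (xs⊆xs++ys Θr _) unboxed∈) ⊆-refl)
    where
    unboxed∈ : ∀ {x} → Unbox i A x → x ∈ A ∷ []
    unboxed∈ strip     = here refl
    unboxed∈ (keep k4) = ⊥-elim (no4 k4)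

  reduce : ∀ {R : Set} {j i A n m Γ Ω} → Reduct j i A n m Γ Ω →
           (∀ {Θ} → Transfers j Γ Θ → Θ ⊢[ m ] Ω → R) →
           (∀ {Θ} → Transfers j Γ Θ → Θ ⊢[ n ] A ∷ Ω → A ∷ Θ ⊢[ m ] Ω → R) →
           (∀ {Θ} → Transfers j Γ Θ → Θ ⊢[ n ] A ∷ Ω → RightIntro (suc n) (A ∷ Θ) Ω (□ i A) →
                    □ i A ∷ A ∷ Θ ⊢[ m ] Ω → R) → R
  reduce (unaffected tr E)     k₀ k₁ k₂ = k₀ tr E
  reduce (via-A tr D E)        k₀ k₁ k₂ = k₁ tr D E
  reduce (via-□A tr D □A E)    k₀ k₁ k₂ = k₂ tr D □A E

  mutual
    cut : ∀ A n m {Γ Δ} → Γ ⊢[ n ] A ∷ Δ → A ∷ Γ ⊢[ m ] Δ → Γ ⊢ Δ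
    cut A n m (ax pΓ (here refl)) E = m , weaken E (λ { (here refl) → pΓ ; (there q) → q }) ⊆-refl
    cut A n m (ax pΓ (there q))   E = 0 , ax pΓ q
    cut A n m (⊥ˡ p)              E = 0 , ⊥ˡ p
    cut A n m (⊤ʳ (here refl))    E = cutᴾ ⊤' n m ⊤ᴾ E
    cut A n m (⊤ʳ (there q))      E = 0 , ⊤ʳ q
    cut A (suc n) m (¬ˡ p D) E =
      by₁ (¬ˡ p) (cut A n m (weaken D ⊆-refl swap⊆) (weaken E ⊆-refl there))
    cut A (suc n) m (¬ʳ (here refl) D) E = cutᴾ A (suc n) m (¬ᴾ D) E
    cut A (suc n) m (¬ʳ (there q) D) E =
      by₁ (¬ʳ q) (cut A n m D (weaken E (∷⁺ʳ _ there) ⊆-refl))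
    cut A (suc n) m (∧ˡ p D) E =
      by₁ (∧ˡ p) (cut A n m D (weaken E (∷⁺ʳ _ there²) ⊆-refl))
    cut A (suc n) m (∧ʳ (here refl) D₁ D₂) E = cutᴾ A (suc n) m (∧ᴾ D₁ D₂) E
    cut A (suc n) m (∧ʳ (there q) D₁ D₂) E =
      by₂ (∧ʳ q) (cut A n m (weaken D₁ ⊆-refl swap⊆) (weaken E ⊆-refl there))
                 (cut A n m (weaken D₂ ⊆-refl swap⊆) (weaken E ⊆-refl there))
    cut A (suc n) m (∨ˡ p D₁ D₂) E =
      by₂ (∨ˡ p) (cut A n m D₁ (weaken E (∷⁺ʳ _ there) ⊆-refl))
                 (cut A n m D₂ (weaken E (∷⁺ʳ _ there) ⊆-refl))
    cut A (suc n) m (∨ʳ (here refl) D) E = cutᴾ A (suc n) m (∨ᴾ D) E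
    cut A (suc n) m (∨ʳ (there q) D) E =
      by₁ (∨ʳ q) (cut A n m (weaken D ⊆-refl rotate⊆) (weaken E ⊆-refl there²))
    cut A (suc n) m (⇒ˡ p D₁ D₂) E =
      by₂ (⇒ˡ p) (cut A n m (weaken D₁ ⊆-refl swap⊆) (weaken E ⊆-refl there))
                 (cut A n m D₂ (weaken E (∷⁺ʳ _ there) ⊆-refl))
    cut A (suc n) m (⇒ʳ (here refl) D) E = cutᴾ A (suc n) m (⇒ᴾ D) E
    cut A (suc n) m (⇒ʳ (there q) D) E =
      by₁ (⇒ʳ q) (cut A n m (weaken D ⊆-refl swap⊆) (weaken E (∷⁺ʳ _ there) there))
    cut A (suc n) m (tˡ p iN kt D) E =
      by₁ (tˡ p iN kt) (cut A n m D (weaken E (∷⁺ʳ _ there) ⊆-refl))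
    cut A (suc n) m (□ʳ (here refl) iN ts D) E = cutᴾ A (suc n) m (□ᴾ iN ts D) E
    cut A (suc n) m (□ʳ (there q) iN ts D)   E = suc n , □ʳ q iN ts D
    cut A (suc n) m (dᴳ jN kd ts D)          E = suc n , dᴳ jN kd ts D

    cut' : ∀ A {Γ Δ} → Γ ⊢ A ∷ Δ → A ∷ Γ ⊢ Δ → Γ ⊢ Δ
    cut' A (n , D) (m , E) = cut A n m D E

    cutᴾ : ∀ A n m {Γ Δ} → RightIntro n Γ Δ A → A ∷ Γ ⊢[ m ] Δ → Γ ⊢ Δ
    cutᴾ A n m () (ax (here refl) q)
    cutᴾ A n m pd (ax (there p) q) = 0 , ax p q
    cutᴾ A n m () (⊥ˡ (here refl))
    cutᴾ A n m pd (⊥ˡ (there p))   = 0 , ⊥ˡ p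
    cutᴾ A n m pd (⊤ʳ q)           = 0 , ⊤ʳ q
    cutᴾ (¬' A) (suc n) (suc m) pd@(¬ᴾ D) E@(¬ˡ (here refl) E') =
      cut' A (cutᴾ (¬' A) (suc n) m (weakenᴾ pd ⊆-refl there) E')
             (cut (¬' A) n (suc m) D (weaken E (∷⁺ʳ _ there) ⊆-refl))
    cutᴾ A n (suc m) pd (¬ˡ (there p) E') =
      by₁ (¬ˡ p) (cutᴾ A n m (weakenᴾ pd ⊆-refl there) E')
    cutᴾ A n (suc m) pd (¬ʳ q E') =
      by₁ (¬ʳ q) (cutᴾ A n m (weakenᴾ pd there ⊆-refl) (weaken E' swap⊆ ⊆-refl))
    cutᴾ (A ∧' B) (suc n) (suc m) pd@(∧ᴾ D₁ D₂) E@(∧ˡ (here refl) E') =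
      let Dᴬ  = cut (A ∧' B) n (suc m) (weaken D₁ ⊆-refl swap⊆) (weaken E ⊆-refl there)
          Dᴮ  = cut (A ∧' B) n (suc m) (weaken D₂ ⊆-refl swap⊆) (weaken E ⊆-refl there)
          Eᴬᴮ = cutᴾ (A ∧' B) (suc n) m (weakenᴾ pd there² ⊆-refl) (weaken E' rotate⊆ ⊆-refl)
      in cut' A Dᴬ (cut' B (weaken' Dᴮ there ⊆-refl) (weaken' Eᴬᴮ swap⊆ ⊆-refl))
    cutᴾ A n (suc m) pd (∧ˡ (there p) E') =
      by₁ (∧ˡ p) (cutᴾ A n m (weakenᴾ pd there² ⊆-refl) (weaken E' rotate⊆ ⊆-refl))
    cutᴾ A n (suc m) pd (∧ʳ q E₁ E₂) =
      by₂ (∧ʳ q) (cutᴾ A n m (weakenᴾ pd ⊆-refl there) E₁) (cutᴾ A n m (weakenᴾ pd ⊆-refl there) E₂)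
    cutᴾ (A ∨' B) (suc n) (suc m) pd@(∨ᴾ D) E@(∨ˡ (here refl) E₁ E₂) =
      let Dᴬᴮ = cut (A ∨' B) n (suc m) (weaken D ⊆-refl rotate⊆) (weaken E ⊆-refl there²)
          Eᴬ  = cutᴾ (A ∨' B) (suc n) m (weakenᴾ pd there ⊆-refl) (weaken E₁ swap⊆ ⊆-refl)
          Eᴮ  = cutᴾ (A ∨' B) (suc n) m (weakenᴾ pd there ⊆-refl) (weaken E₂ swap⊆ ⊆-refl)
      in cut' B (cut' A Dᴬᴮ (weaken' Eᴬ ⊆-refl there)) Eᴮ
    cutᴾ A n (suc m) pd (∨ˡ (there p) E₁ E₂) =
      by₂ (∨ˡ p) (cutᴾ A n m (weakenᴾ pd there ⊆-refl) (weaken E₁ swap⊆ ⊆-refl))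
                 (cutᴾ A n m (weakenᴾ pd there ⊆-refl) (weaken E₂ swap⊆ ⊆-refl))
    cutᴾ A n (suc m) pd (∨ʳ q E') =
      by₁ (∨ʳ q) (cutᴾ A n m (weakenᴾ pd ⊆-refl there²) E')
    cutᴾ (A ⇒' B) (suc n) (suc m) pd@(⇒ᴾ D) E@(⇒ˡ (here refl) E₁ E₂) =
      let Dᴬ  = cutᴾ (A ⇒' B) (suc n) m (weakenᴾ pd ⊆-refl there) E₁
          Dᴮ  = cut (A ⇒' B) n (suc m) (weaken D ⊆-refl swap⊆) (weaken E (∷⁺ʳ _ there) there)
          Eᴮ  = cutᴾ (A ⇒' B) (suc n) m (weakenᴾ pd there ⊆-refl) (weaken E₂ swap⊆ ⊆-refl)
      in cut' A Dᴬ (cut' B Dᴮ (weaken' Eᴮ (∷⁺ʳ _ there) ⊆-refl))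
    cutᴾ A n (suc m) pd (⇒ˡ (there p) E₁ E₂) =
      by₂ (⇒ˡ p) (cutᴾ A n m (weakenᴾ pd ⊆-refl there) E₁)
                 (cutᴾ A n m (weakenᴾ pd there ⊆-refl) (weaken E₂ swap⊆ ⊆-refl))
    cutᴾ A n (suc m) pd (⇒ʳ q E') =
      by₁ (⇒ʳ q) (cutᴾ A n m (weakenᴾ pd there there) (weaken E' swap⊆ ⊆-refl))
    cutᴾ (□ i A) (suc n) (suc m) pd@(□ᴾ iN ts D) (tˡ (here refl) _ kt E') =
      cut' A (absorb-T iN kt ts (n , weaken D ∈-++⁺ˡ [A]⊆A∷Δ))
             (cutᴾ (□ i A) (suc n) m (weakenᴾ pd there ⊆-refl) (weaken E' swap⊆ ⊆-refl))
    cutᴾ A n (suc m) pd (tˡ (there p) iN kt E') =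
      by₁ (tˡ p iN kt) (cutᴾ A n m (weakenᴾ pd there ⊆-refl) (weaken E' swap⊆ ⊆-refl))
    cutᴾ A n (suc m) pd (□ʳ q iN ts E') = by□ (□ʳ q iN) (cut-□ A n m pd iN ts E')
    cutᴾ A n (suc m) pd (dᴳ jN kd ts E') = by□ (dᴳ jN kd) (cut-□ A n m pd jN ts E')

    cut-□ : ∀ A n m {j Γ Δ Θ Ω} → RightIntro n Γ Δ A → j ∈ N → Transfers j (A ∷ Γ) Θ →
            Θ ⊢[ m ] Ω → ∃[ Θ' ] (Transfers j Γ Θ' × Θ' ⊢ Ω)
    cut-□ _ n m ⊤ᴾ       _ ts E = _ , Transfers-drop _ ts , (m , E)
    cut-□ _ n m (¬ᴾ _)   _ ts E = _ , Transfers-drop _ ts , (m , E)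
    cut-□ _ n m (∧ᴾ _ _) _ ts E = _ , Transfers-drop _ ts , (m , E)
    cut-□ _ n m (∨ᴾ _)   _ ts E = _ , Transfers-drop _ ts , (m , E)
    cut-□ _ n m (⇒ᴾ _)   _ ts E = _ , Transfers-drop _ ts , (m , E)
    -- Eliminating the Reduct with reduce rather than with keeps □ i A visible to the termination
    -- checker as the cut formula of the recursive call.
    cut-□ (□ i A) (suc n) m (□ᴾ iN ts D) jN ts' E =
      reduce (reduct iN ts D jN ts' E)
        (λ tr E' → _ , tr , (m , E'))
        (λ tr Dᴬ Eᴬ → _ , tr , cut' A (n , Dᴬ) (m , Eᴬ))
        (λ tr Dᴬ □A E□ → _ , tr , cut' A (n , Dᴬ) (cutᴾ (□ i A) (suc n) m □A E□))

connective : Fm → ℕ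
connective (var _)  = 0
connective ⊥'       = 1
connective ⊤'       = 2
connective (¬' _)   = 3
connective (_ ∧' _) = 4
connective (_ ∨' _) = 5
connective (_ ⇒' _) = 6
connective (□ _ _)  = 7

infix 4 _≟_

-- Comparing connectives first lets the coverage checker discharge all mismatched pairs.
mutual
  _≟_ : DecidableEquality Fm
  A ≟ B with connective A ℕ.≟ connective B
  ... | yes same = same-connective A B same
  ... | no differ = no (differ ∘ cong connective)

  same-connective : ∀ A B → connective A ≡ connective B → Dec (A ≡ B)
  same-connective (var p)  (var q)  refl = map′ (cong var) (λ { refl → refl }) (p ℕ.≟ q)
  same-connective ⊥'       ⊥'       refl = yes refl
  same-connective ⊤'       ⊤'       refl = yes refl
  same-connective (¬' A)   (¬' B)   refl = map′ (cong ¬'_) (λ { refl → refl }) (A ≟ B)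
  same-connective (A ∧' B) (C ∧' D) refl =
    map′ (λ (p , q) → cong₂ _∧'_ p q) (λ { refl → refl , refl }) (A ≟ C ×-dec B ≟ D)
  same-connective (A ∨' B) (C ∨' D) refl =
    map′ (λ (p , q) → cong₂ _∨'_ p q) (λ { refl → refl , refl }) (A ≟ C ×-dec B ≟ D)
  same-connective (A ⇒' B) (C ⇒' D) refl =
    map′ (λ (p , q) → cong₂ _⇒'_ p q) (λ { refl → refl , refl }) (A ≟ C ×-dec B ≟ D)
  same-connective (□ i A)  (□ j B)  refl =
    map′ (λ (p , q) → cong₂ □ p q) (λ { refl → refl , refl }) (i ℕ.≟ j ×-dec A ≟ B)

data Signed : Set where
  ante succ : Fm → Signed

antecedents succedents : List Signed → List Fm
antecedents []           = []
antecedents (ante A ∷ r) = A ∷ antecedents r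
antecedents (succ _ ∷ r) = antecedents r
succedents []           = []
succedents (ante _ ∷ r) = succedents r
succedents (succ A ∷ r) = A ∷ succedents r

formula : Signed → Fm
formula (ante A) = A
formula (succ A) = A

weight : Fm → ℕ
weight (¬' A)   = suc (weight A)
weight (A ∧' B) = suc (weight A + weight B)
weight (A ∨' B) = suc (weight A + weight B)
weight (A ⇒' B) = suc (weight A + weight B)
weight _        = 1

weights : List Signed → ℕ
weights []      = 0
weights (s ∷ r) = weight (formula s) + weights r

module _ (A B : Fm) {r n : ℕ} (h : suc (weight A + weight B + r) ≤ n) where
  both< : suc (weight A + (weight B + r)) ≤ n
  both< = subst (λ z → suc z ≤ n) (+-assoc (weight A) (weight B) r) h

  left< : suc (weight A + r) ≤ n
  left< = ≤-trans (s≤s (+-monoˡ-≤ r (m≤m+n (weight A) (weight B)))) h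

  right< : suc (weight B + r) ≤ n
  right< = ≤-trans (s≤s (+-monoˡ-≤ r (m≤n+m (weight B) (weight A)))) h

module Completeness (𝔇 : Description) (tc : TransitiveClosed 𝔇) (sa : StandingAssumption 𝔇) where
  open Description 𝔇
  open Calculus 𝔇
  open CutElimination 𝔇 tc sa using (cut')
  open import Data.List.Membership.DecPropositional _≟_ using (_∈?_)

  identity : ∀ {X Γ Δ} → WF N X → X ∈ Γ → X ∈ Δ → Γ ⊢ Δ
  identity wf-var        m q = 0 , ax m q
  identity wf-⊥          m q = 0 , ⊥ˡ m
  identity wf-⊤          m q = 0 , ⊤ʳ q
  identity (wf-¬ w)      m q = by₁ (¬ʳ q) (by₁ (¬ˡ (there m)) (identity w (here refl) (here refl)))
  identity (wf-∧ wa wb)  m q =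
    by₂ (∧ʳ q) (by₁ (∧ˡ m) (identity wa (here refl) (here refl)))
               (by₁ (∧ˡ m) (identity wb (there (here refl)) (here refl)))
  identity (wf-∨ wa wb)  m q =
    by₂ (∨ˡ m) (by₁ (∨ʳ q) (identity wa (here refl) (here refl)))
               (by₁ (∨ʳ q) (identity wb (here refl) (there (here refl))))
  identity (wf-⇒ wa wb)  m q =
    by₁ (⇒ʳ q) (by₂ (⇒ˡ (there m)) (identity wa (here refl) (here refl))
                                   (identity wb (here refl) (here refl)))
  identity (wf-□ iN w)   m q =
    by₁ (□ʳ q iN (transfer m iN (⪯-refl iN) strip ∷ [])) (identity w (here refl) (here refl))

  data Atomic : Fm → Set where
    atom-var : ∀ {p} → Atomic (var p)
    atom-□   : ∀ {i A} → WF N (□ i A) → Atomic (□ i A)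

  Atomic-WF : ∀ {X} → Atomic X → WF N X
  Atomic-WF atom-var   = wf-var
  Atomic-WF (atom-□ w) = w

  ⊨-Atomic : ∀ {v X} → Atomic X → v ⊨ X → T (v X)
  ⊨-Atomic atom-var   = holds
  ⊨-Atomic (atom-□ _) = holds

  Atomic-⊨ : ∀ {v X} → Atomic X → T (v X) → v ⊨ X
  Atomic-⊨ atom-var   = ⊨⟨_⟩
  Atomic-⊨ (atom-□ _) = ⊨⟨_⟩

  -- Unless Γ and Δ share an atom, the valuation making exactly the atoms of Γ true refutes Γ ⇒ Δ.
  atomic-complete : ∀ {Γ Δ} → All Atomic Γ → All Atomic Δ → Valid (Γ ⇒ Δ) → Γ ⊢ Δ
  atomic-complete {Γ} {Δ} aΓ aΔ valid with any? (_∈? Γ) Δ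
  ... | yes common =
    let X , X∈Δ , X∈Γ = find common in identity (Atomic-WF (All.lookup aΔ X∈Δ)) X∈Γ X∈Δ
  ... | no disjoint = ⊥-elim (disjoint (shared aΔ (valid {v = in-Γ} Γ-true)))
    where
    in-Γ : Valuation
    in-Γ X = isYes (X ∈? Γ)

    Γ-true : All (in-Γ ⊨_) Γ
    Γ-true = All.tabulate λ m → Atomic-⊨ (All.lookup aΓ m) (fromWitness m)

    shared : ∀ {Δ} → All Atomic Δ → Any (in-Γ ⊨_) Δ → Any (_∈ Γ) Δ
    shared (a ∷ _)  (here x)  = here (toWitness {a? = _ ∈? Γ} (⊨-Atomic a x))
    shared (_ ∷ as) (there δ) = there (shared as δ)

  shiftˡ : ∀ r {X Γa Δ} → Valid (X ∷ antecedents r ++ Γa ⇒ Δ) → Valid (antecedents r ++ X ∷ Γa ⇒ Δ)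
  shiftˡ r {X} {Γa} valid = ⊨ˢ-resp-↭ (↭-sym (shift X (antecedents r) Γa)) ↭-refl valid

  shiftʳ : ∀ r {X Δa Γ} → Valid (Γ ⇒ X ∷ succedents r ++ Δa) → Valid (Γ ⇒ succedents r ++ X ∷ Δa)
  shiftʳ r {X} {Δa} valid = ⊨ˢ-resp-↭ ↭-refl (↭-sym (shift X (succedents r) Δa)) valid

  unshiftˡ : ∀ r {X Γa Δ} → antecedents r ++ X ∷ Γa ⊢ Δ → X ∷ antecedents r ++ Γa ⊢ Δ
  unshiftˡ r {X} {Γa} D = weaken' D (⊆-reflexive-↭ (shift X (antecedents r) Γa)) ⊆-refl

  unshiftʳ : ∀ r {X Δa Γ} → Γ ⊢ succedents r ++ X ∷ Δa → Γ ⊢ X ∷ succedents r ++ Δa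
  unshiftʳ r {X} {Δa} D = weaken' D ⊆-refl (⊆-reflexive-↭ (shift X (succedents r) Δa))

  search : ∀ n todo {Γa Δa} → weights todo < n → All (WF N ∘ formula) todo →
           All Atomic Γa → All Atomic Δa → Valid (antecedents todo ++ Γa ⇒ succedents todo ++ Δa) →
           antecedents todo ++ Γa ⊢ succedents todo ++ Δa
  search (suc n) [] _ _ aΓ aΔ valid = atomic-complete aΓ aΔ valid
  search (suc n) (ante (var p) ∷ r) (s≤s h) (_ ∷ ws) aΓ aΔ valid =
    unshiftˡ r (search n r h ws (atom-var ∷ aΓ) aΔ (shiftˡ r valid))
  search (suc n) (ante (□ i A) ∷ r) (s≤s h) (w ∷ ws) aΓ aΔ valid =
    unshiftˡ r (search n r h ws (atom-□ w ∷ aΓ) aΔ (shiftˡ r valid))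
  search (suc n) (succ (var p) ∷ r) (s≤s h) (_ ∷ ws) aΓ aΔ valid =
    unshiftʳ r (search n r h ws aΓ (atom-var ∷ aΔ) (shiftʳ r valid))
  search (suc n) (succ (□ i A) ∷ r) (s≤s h) (w ∷ ws) aΓ aΔ valid =
    unshiftʳ r (search n r h ws aΓ (atom-□ w ∷ aΔ) (shiftʳ r valid))
  search (suc n) (ante ⊥' ∷ r) _ _ _ _ _ = 0 , ⊥ˡ (here refl)
  search (suc n) (succ ⊤' ∷ r) _ _ _ _ _ = 0 , ⊤ʳ (here refl)
  search (suc n) (ante ⊤' ∷ r) (s≤s h) (_ ∷ ws) aΓ aΔ valid =
    weaken' (search n r h ws aΓ aΔ (λ γ → valid (_ ∷ γ))) there ⊆-refl
  search (suc n) (succ ⊥' ∷ r) (s≤s h) (_ ∷ ws) aΓ aΔ valid =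
    weaken' (search n r h ws aΓ aΔ (Any.tail (λ { ⊨⟨ () ⟩ }) ∘ valid)) ⊆-refl there
  search (suc n) (ante (¬' A) ∷ r) (s≤s h) (wf-¬ w ∷ ws) aΓ aΔ valid =
    by₁ (¬ˡ (here refl))
      (weaken' (search n (succ A ∷ r) h (w ∷ ws) aΓ aΔ (to ⊨ˢ-¬ˡ valid)) there ⊆-refl)
  search (suc n) (succ (¬' A) ∷ r) (s≤s h) (wf-¬ w ∷ ws) aΓ aΔ valid =
    by₁ (¬ʳ (here refl))
      (weaken' (search n (ante A ∷ r) h (w ∷ ws) aΓ aΔ (to ⊨ˢ-¬ʳ valid)) ⊆-refl there)
  search (suc n) (ante (A ∧' B) ∷ r) (s≤s h) (wf-∧ wa wb ∷ ws) aΓ aΔ valid =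
    by₁ (∧ˡ (here refl))
      (weaken' (search n (ante A ∷ ante B ∷ r) (both< A B h) (wa ∷ wb ∷ ws) aΓ aΔ (to ⊨ˢ-∧ˡ valid))
               (∷⁺ʳ _ (∷⁺ʳ _ there)) ⊆-refl)
  search (suc n) (succ (A ∧' B) ∷ r) (s≤s h) (wf-∧ wa wb ∷ ws) aΓ aΔ valid =
    by₂ (∧ʳ (here refl))
      (weaken' (search n (succ A ∷ r) (left< A B h) (wa ∷ ws) aΓ aΔ (proj₁ (to ⊨ˢ-∧ʳ valid)))
               ⊆-refl (∷⁺ʳ _ there))
      (weaken' (search n (succ B ∷ r) (right< A B h) (wb ∷ ws) aΓ aΔ (proj₂ (to ⊨ˢ-∧ʳ valid)))
               ⊆-refl (∷⁺ʳ _ there))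
  search (suc n) (ante (A ∨' B) ∷ r) (s≤s h) (wf-∨ wa wb ∷ ws) aΓ aΔ valid =
    by₂ (∨ˡ (here refl))
      (weaken' (search n (ante A ∷ r) (left< A B h) (wa ∷ ws) aΓ aΔ (proj₁ (to ⊨ˢ-∨ˡ valid)))
               (∷⁺ʳ _ there) ⊆-refl)
      (weaken' (search n (ante B ∷ r) (right< A B h) (wb ∷ ws) aΓ aΔ (proj₂ (to ⊨ˢ-∨ˡ valid)))
               (∷⁺ʳ _ there) ⊆-refl)
  search (suc n) (succ (A ∨' B) ∷ r) (s≤s h) (wf-∨ wa wb ∷ ws) aΓ aΔ valid =
    by₁ (∨ʳ (here refl))
      (weaken' (search n (succ A ∷ succ B ∷ r) (both< A B h) (wa ∷ wb ∷ ws) aΓ aΔ (to ⊨ˢ-∨ʳ valid))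
               ⊆-refl (∷⁺ʳ _ (∷⁺ʳ _ there)))
  search (suc n) (ante (A ⇒' B) ∷ r) (s≤s h) (wf-⇒ wa wb ∷ ws) aΓ aΔ valid =
    by₂ (⇒ˡ (here refl))
      (weaken' (search n (succ A ∷ r) (left< A B h) (wa ∷ ws) aΓ aΔ (proj₁ (to ⊨ˢ-⇒ˡ valid)))
               there ⊆-refl)
      (weaken' (search n (ante B ∷ r) (right< A B h) (wb ∷ ws) aΓ aΔ (proj₂ (to ⊨ˢ-⇒ˡ valid)))
               (∷⁺ʳ _ there) ⊆-refl)
  search (suc n) (succ (A ⇒' B) ∷ r) (s≤s h) (wf-⇒ wa wb ∷ ws) aΓ aΔ valid =
    by₁ (⇒ʳ (here refl))
      (weaken' (search n (ante A ∷ succ B ∷ r) (both< A B h) (wa ∷ wb ∷ ws) aΓ aΔ (to ⊨ˢ-⇒ʳ valid))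
               ⊆-refl (∷⁺ʳ _ there))

  tautology : ∀ {A} → WF N A → Taut A → [] ⊢ A ∷ []
  tautology {A} w τ =
    search (suc (weight A + 0)) (succ A ∷ []) ≤-refl (w ∷ []) [] [] λ {v} _ → here ⊨⟨ from T-≡ (τ v) ⟩

  L-WF : ∀ {A} → L 𝔇 A → WF N A
  L-WF (taut w _)            = w
  L-WF (axK iN wa wb)        = wf-⇒ (wf-□ iN (wf-⇒ wa wb)) (wf-⇒ (wf-□ iN wa) (wf-□ iN wb))
  L-WF (axD iN _)            = wf-¬ (wf-□ iN wf-⊥)
  L-WF (axT iN wa _)         = wf-⇒ (wf-□ iN wa) wa
  L-WF (ax4 iN wa _)         = wf-⇒ (wf-□ iN wa) (wf-□ iN (wf-□ iN wa))
  L-WF (axInc iN jN wa _)    = wf-⇒ (wf-□ jN wa) (wf-□ iN wa)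
  L-WF (mp dr _) with L-WF dr
  ... | wf-⇒ _ wb = wb
  L-WF (nec iN dr)           = wf-□ iN (L-WF dr)

  L⇒⊢ : ∀ {A} → L 𝔇 A → [] ⊢ A ∷ []
  L⇒⊢ (taut w τ) = tautology w τ
  L⇒⊢ (axK iN wa wb) =
    by₁ (⇒ʳ (here refl)) (by₁ (⇒ʳ (here refl))
      (by₁ (□ʳ (here refl) iN (transfer (there (here refl)) iN (⪯-refl iN) strip ∷
                               transfer (here refl) iN (⪯-refl iN) strip ∷ []))
        (by₂ (⇒ˡ (here refl)) (identity wa (there (here refl)) (here refl))
                              (identity wb (here refl) (here refl)))))
  L⇒⊢ (axD iN kd) =
    by₁ (¬ʳ (here refl))
      (by₁ (dᴳ iN (inj₁ kd) (transfer (here refl) iN (⪯-refl iN) strip ∷ [])) (0 , ⊥ˡ (here refl)))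
  L⇒⊢ (axT iN wa kt) =
    by₁ (⇒ʳ (here refl)) (by₁ (tˡ (here refl) iN kt) (identity wa (here refl) (here refl)))
  L⇒⊢ (ax4 iN wa k4) =
    by₁ (⇒ʳ (here refl)) (by₁ (□ʳ (here refl) iN (transfer (here refl) iN (⪯-refl iN) (keep k4) ∷ []))
      (identity (wf-□ iN wa) (here refl) (here refl)))
  L⇒⊢ (axInc iN jN wa ij) =
    by₁ (⇒ʳ (here refl)) (by₁ (□ʳ (here refl) iN (transfer (here refl) jN ij strip ∷ []))
      (identity wa (here refl) (here refl)))
  L⇒⊢ (mp {A} dr₁ dr₂) with L-WF dr₁
  ... | wf-⇒ _ wb =
    cut' (A ⇒' _) (weaken' (L⇒⊢ dr₁) ⊆-refl [A]⊆A∷Δ)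
      (by₂ (⇒ˡ (here refl)) (weaken' (L⇒⊢ dr₂) (λ ()) [A]⊆A∷Δ) (identity wb (here refl) (here refl)))
  L⇒⊢ (nec iN dr) = by₁ (□ʳ (here refl) iN []) (L⇒⊢ dr)

module Translation (𝔇 : Description) where
  open Description 𝔇
  open Calculus 𝔇

  ∈⇒↭ : ∀ {X : Fm} {Γ} → X ∈ Γ → ∃[ Γ' ] Γ ↭ X ∷ Γ'
  ∈⇒↭ X∈Γ with Γ₁ , Γ₂ , refl ← ∈-∃++ X∈Γ = Γ₁ ++ Γ₂ , shift _ Γ₁ Γ₂

  ≈-refl : ∀ S → S ≈ S
  ≈-refl (one (Γ ⇒ Δ))        = one≈ ↭-refl ↭-refl
  ≈-refl (S /[ k ] (Γ ⇒ Δ))   = ext≈ (≈-refl S) ↭-refl ↭-refl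

  EA-↭ : ∀ P {Γ Γ' Δ Δ'} → Γ ↭ Γ' → Δ ↭ Δ' → EA 𝔇 (P ⊳ (Γ ⇒ Δ)) → EA 𝔇 (P ⊳ (Γ' ⇒ Δ'))
  EA-↭ ε          p q = perm (one≈ p q)
  EA-↭ (G /⟨ k ⟩) p q = perm (ext≈ (≈-refl G) p q)

  contractˡ : ∀ P {X Γ Δ} → X ∈ Γ → EA 𝔇 (P ⊳ (X ∷ Γ ⇒ Δ)) → EA 𝔇 (P ⊳ (Γ ⇒ Δ))
  contractˡ P {X} X∈Γ D with Γ' , p ← ∈⇒↭ X∈Γ =
    EA-↭ P (↭-sym p) ↭-refl (conL {P = P} (EA-↭ P (prep X p) ↭-refl D))

  contractʳ : ∀ P {X Γ Δ} → X ∈ Δ → EA 𝔇 (P ⊳ (Γ ⇒ X ∷ Δ)) → EA 𝔇 (P ⊳ (Γ ⇒ Δ))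
  contractʳ P {X} X∈Δ D with Δ' , p ← ∈⇒↭ X∈Δ =
    EA-↭ P ↭-refl (↭-sym p) (conR {P = P} (EA-↭ P ↭-refl (prep X p) D))

  contract* : ∀ P {Γ Δ} Ξ → Ξ ⊆ Γ → EA 𝔇 (P ⊳ (Ξ ++ Γ ⇒ Δ)) → EA 𝔇 (P ⊳ (Γ ⇒ Δ))
  contract* P []      _ D = D
  contract* P (X ∷ Ξ) s D = contract* P Ξ (s ∘ there) (contractˡ P (∈-++⁺ʳ Ξ (s (here refl))) D)

  last-↭ : ∀ {G i Θ Θ' Π} → Θ ↭ Θ' → EA 𝔇 (G /[ i ] (Θ ⇒ Π)) → EA 𝔇 (G /[ i ] (Θ' ⇒ Π))
  last-↭ p = perm (ext≈ (≈-refl _) p ↭-refl)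

  sources : ∀ {i Γ Θ} → Transfers i Γ Θ → List Fm
  sources []                            = []
  sources (transfer {k} {B} _ _ _ _ ∷ ts) = □ k B ∷ sources ts

  sources⊆ : ∀ {i Γ Θ} (ts : Transfers i Γ Θ) → sources ts ⊆ Γ
  sources⊆ (transfer m _ _ _ ∷ ts) (here refl) = m
  sources⊆ (transfer _ _ _ _ ∷ ts) (there p)   = sources⊆ ts p

  transfer-all : ∀ P {i Γ Δ Θ} → i ∈ N → (ts : Transfers i Γ Θ) → ∀ Θ₀ Π →
                 EA 𝔇 ((P ⊳ (Γ ⇒ Δ)) /[ i ] (Θ ++ Θ₀ ⇒ Π)) →
                 EA 𝔇 ((P ⊳ (sources ts ++ Γ ⇒ Δ)) /[ i ] (Θ₀ ⇒ Π))
  transfer-all P iN [] Θ₀ Π D = D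
  transfer-all P iN (_∷_ {x = X} {xs = Θ} (transfer _ kN ik strip) ts) Θ₀ Π D =
    □L {P = P} kN iN ik (transfer-all P iN ts (X ∷ Θ₀) Π (last-↭ (↭-sym (shift X Θ Θ₀)) D))
  transfer-all P iN (_∷_ {x = X} {xs = Θ} (transfer _ kN ik (keep k4)) ts) Θ₀ Π D =
    f4 {P = P} kN iN ik k4 (transfer-all P iN ts (X ∷ Θ₀) Π (last-↭ (↭-sym (shift X Θ Θ₀)) D))

  ⊬[]⇒[] : ∀ {n} → ¬ ([] ⊢[ n ] [])
  ⊬[]⇒[] (ax () _)
  ⊬[]⇒[] (⊥ˡ ())
  ⊬[]⇒[] (⊤ʳ ())
  ⊬[]⇒[] (¬ˡ () _)
  ⊬[]⇒[] (¬ʳ () _)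
  ⊬[]⇒[] (∧ˡ () _)
  ⊬[]⇒[] (∧ʳ () _ _)
  ⊬[]⇒[] (∨ˡ () _ _)
  ⊬[]⇒[] (∨ʳ () _)
  ⊬[]⇒[] (⇒ˡ () _ _)
  ⊬[]⇒[] (⇒ʳ () _)
  ⊬[]⇒[] (tˡ () _ _ _)
  ⊬[]⇒[] (□ʳ () _ _ _)
  ⊬[]⇒[] (dᴳ _ _ [] D) = ⊬[]⇒[] D
  ⊬[]⇒[] (dᴳ _ _ (transfer () _ _ _ ∷ _) _)

  ⊢⇒EA : ∀ {n Γ Δ} → Γ ⊢[ n ] Δ → ∀ P → EA 𝔇 (P ⊳ (Γ ⇒ Δ))
  ⊢⇒EA (ax p q) P with _ , p' ← ∈⇒↭ p | _ , q' ← ∈⇒↭ q = EA-↭ P (↭-sym p') (↭-sym q') (init {P = P})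
  ⊢⇒EA (⊥ˡ p)   P with _ , p' ← ∈⇒↭ p = EA-↭ P (↭-sym p') ↭-refl (⊥L {P = P})
  ⊢⇒EA (⊤ʳ q)   P with _ , q' ← ∈⇒↭ q = EA-↭ P ↭-refl (↭-sym q') (⊤R {P = P})
  ⊢⇒EA (¬ˡ p D)   P = contractˡ P p (¬L {P = P} (⊢⇒EA D P))
  ⊢⇒EA (¬ʳ p D)   P = contractʳ P p (¬R {P = P} (⊢⇒EA D P))
  ⊢⇒EA (∧ˡ p D)   P = contractˡ P p (∧L {P = P} (⊢⇒EA D P))
  ⊢⇒EA (∧ʳ p D E) P = contractʳ P p (∧R {P = P} (⊢⇒EA D P) (⊢⇒EA E P))
  ⊢⇒EA (∨ˡ p D E) P = contractˡ P p (∨L {P = P} (⊢⇒EA D P) (⊢⇒EA E P))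
  ⊢⇒EA (∨ʳ p D)   P = contractʳ P p (∨R {P = P} (⊢⇒EA D P))
  ⊢⇒EA (⇒ˡ p D E) P = contractˡ P p (⇒L {P = P} (⊢⇒EA D P) (⊢⇒EA E P))
  ⊢⇒EA (⇒ʳ p D)   P = contractʳ P p (⇒R {P = P} (⊢⇒EA D P))
  ⊢⇒EA (tˡ p iN kt D) P = contractˡ P p (t {P = P} iN kt (⊢⇒EA D P))
  ⊢⇒EA {Γ = Γ} {Δ} (□ʳ {Θ = Θ} p iN ts D) P =
    contractʳ P p (contract* P (sources ts) (sources⊆ ts)
      (□R {P = P} iN (transfer-all P iN ts [] _
        (last-↭ (↭-reflexive (sym (++-identityʳ Θ))) (⊢⇒EA D ((P ⊳ (Γ ⇒ Δ)) /⟨ _ ⟩))))))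
  ⊢⇒EA (dᴳ jN kd [] D) P = ⊥-elim (⊬[]⇒[] D)
  -- The first transfer supplies the principal box of the d rule; Θ is nonempty by ⊬[]⇒[].
  ⊢⇒EA {Γ = Γ} {Δ} (dᴳ jN kd ts@(_∷_ {x = X} {xs = Θ} (transfer {B = B} m kN jk _) _) D) P =
    contract* P (_ ∷ sources ts) (λ { (here refl) → m ; (there q) → sources⊆ ts q })
      (d {P = P} kN jN jk kd (transfer-all P jN ts (B ∷ []) []
        (last-↭ (↭-sym (++-comm (X ∷ Θ) (B ∷ []))) (wkL {P = (P ⊳ (Γ ⇒ Δ)) /⟨ _ ⟩} (⊢⇒EA D _)))))

mainTheorem5 : (𝔇 : Description) → TransitiveClosed 𝔇 → StandingAssumption 𝔇 →
    (A : Fm) → WF (Description.N 𝔇) A →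
    (L 𝔇 A ⇔ EA 𝔇 (one ([] ⇒ A ∷ [])))
mainTheorem5 𝔇 tc sa A w = mk⇔
  (λ ⊢A → Translation.⊢⇒EA 𝔇 (proj₂ (Completeness.L⇒⊢ 𝔇 tc sa ⊢A)) ε)
  (Soundness.soundness 𝔇 w)
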